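{- Let $p$ be a prime and $w\ge1$. The number of Scopes families of finite cardinality is $\frac1p\binom{pw-2}{p-1}$.
   Context: Let $\mathscr C_p=\{(c_0,\ldots,c_{p-1})\in\mathbb Z^p:\sum c_j=0\}$. For $1\le j\le p-1$, $c\in\mathscr C_p$ is $j$-allowed if $c_j-c_{j-1}\ge w$, and then $\mathrm{sc}_j(c)$ is $c$ with coordinates $c_{j-1}$ and $c_j$ interchanged. $c$ is $0$-allowed if $c_0-c_{p-1}>w$, and then $\mathrm{sc}_0(c)=(c_{p-1}+1,c_1,\ldots,c_{p-2},c_0-1)$. The Scopes families are the equivalence classes of the equivalence relation on $\mathscr C_p$ generated by $c\sim\mathrm{sc}_j(c)$ for all $0\le j\le p-1$ and all $j$-allowed $c$. -}

module Defs where

open import Data.Nat using (ℕ; suc)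
open import Data.Integer using (ℤ; +_; _+_; _-_; _≤_; _<_; 0ℤ; 1ℤ)
open import Data.Fin using (Fin; toℕ)
open import Data.Vec using (Vec; lookup; _[_]≔_; foldr)
open import Data.List using (List)
open import Data.List.Membership.Propositional using (_∈_)
open import Data.Product using (∃)
open import Relation.Binary.PropositionalEquality using (_≡_)
open import Relation.Binary.Construct.Closure.Equivalence using (EqClosure)

sumℤ : ∀ {n} → Vec ℤ n → ℤ
sumℤ = foldr _ _+_ 0ℤ

InC : ∀ {n} → Vec ℤ n → Set
InC c = sumℤ c ≡ 0ℤ

swapAt : ∀ {n} → Vec ℤ n → Fin n → Fin n → Vec ℤ n
swapAt c a b = (c [ a ]≔ lookup c b) [ b ]≔ lookup c a

-- One Scopes move c ↦ sc_j(c) (w is the weight).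
--  * scj : j = toℕ b ∈ {1,…,n-1}, a is index j-1; j-allowed iff c_j - c_{j-1} ≥ w.
--  * sc0 : i0 is index 0, iL is index n-1; 0-allowed iff c_0 - c_{n-1} > w;
--          sc_0(c) = (c_{n-1}+1, c_1, …, c_{n-2}, c_0 - 1).
data ScStep (n w : ℕ) : Vec ℤ n → Vec ℤ n → Set where
  scj : ∀ (c : Vec ℤ n) (a b : Fin n) → toℕ b ≡ suc (toℕ a) →
        + w ≤ lookup c b - lookup c a →
        ScStep n w c (swapAt c a b)
  sc0 : ∀ (c : Vec ℤ n) (i0 iL : Fin n) → toℕ i0 ≡ 0 → suc (toℕ iL) ≡ n →
        + w < lookup c i0 - lookup c iL →
        ScStep n w c ((c [ i0 ]≔ (lookup c iL + 1ℤ)) [ iL ]≔ (lookup c i0 - 1ℤ))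

_∼[_,_]_ : ∀ {n} → Vec ℤ n → ℕ → ℕ → Vec ℤ n → Set
c ∼[ n , w ] d = EqClosure (ScStep _ w) c d

FiniteFamily : (n w : ℕ) → Vec ℤ n → Set
FiniteFamily n w c = ∃ λ (L : List (Vec ℤ n)) → ∀ d → c ∼[ n , w ] d → d ∈ L

-- Reverse the Scopes moves: c ⇝ d when c arises from d by a move sc_ℓ, which needs the cyclic
-- gap of c at ℓ to be at most -w.  The potential Φ c = ∑ᵢ (p cᵢ + i)² increases strictly along ⇝
-- (a move at gap g lowers it by 2pg), and ⇝ is locally confluent: moves at disjoint positions
-- commute, adjacent ones satisfy a braid relation.  So, as in Newman's lemma, a family is finite
-- iff it has a member admitting no inverse move, and that member is unique.  These terminal
-- vectors are those whose p cyclic gaps all exceed -w.  The gaps sum to -1, so adding w - 1 to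
-- them gives a composition of pw - p - 1 into p parts, of which there are C(pw - 2, p - 1).
-- The composition fixes the vector up to an additive constant, hence determines one terminal
-- vector with coordinate sum in [0, p); and the rotation (c₀, …, c_{p-1}) ↦ (c_{p-1} + 1, c₀, …)
-- permutes the terminal vectors, raising the sum by one.  Hence the terminal vectors with sum
-- in [0, p) are the rotations of the N terminal vectors of 𝒞_p, one per finite family.

module Submission where

open import Defs

open import Data.Nat as ℕ using (ℕ; zero; suc; _≤_)
import Data.Nat.Properties as ℕ
open import Data.Nat using (_∸_; _≥_)
open import Data.Nat.Combinatorics using (_C_; nCn≡1; nCk+nC[k+1]≡[n+1]C[k+1]; k>n⇒nCk≡0)
open import Data.Nat.Primality using (Prime; ¬prime[0]; ¬prime[1])
import Data.Nat.Tactic.RingSolver as ℕ-Solver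
import Data.Integer.DivMod as DivMod
open import Data.Integer as ℤ using (ℤ; +_; -[1+_]; -_; _+_; _-_; 0ℤ; 1ℤ)
import Data.Integer.Properties as ℤ
open import Data.Integer.Tactic.RingSolver using (solve-∀; solve)
open import Data.Fin using (Fin; zero; suc; toℕ; fromℕ; inject₁; lower₁; punchIn)
import Data.Fin.Properties as Fin
open import Data.Vec as Vec using (Vec; []; _∷_; _∷ʳ_; lookup; _[_]≔_)
import Data.Vec.Properties as Vec
open import Data.List as List using (List; length; map; _++_)
import Data.List.Properties as List
open import Data.List.Membership.Propositional using (_∈_)
open import Data.List.Membership.Propositional.Properties
  using (∈-map⁺; ∈-map⁻; ∈-++⁺ˡ; ∈-++⁺ʳ; ∈-++⁻; ∈-lookup; ∈-cartesianProductWith⁺; ∈-filter⁺; ∈-filter⁻)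
open import Data.List.Membership.Propositional.Properties.WithK using (unique∧set⇒bag)
open import Data.List.Relation.Binary.BagAndSetEquality using (∼bag⇒↭)
open import Data.List.Relation.Binary.Permutation.Propositional.Properties using (↭-length)
open import Data.List.Relation.Unary.Any as Any using (here; there)
import Data.List.Relation.Unary.Any.Properties as Any
import Data.List.Relation.Unary.All as All
import Data.List.Relation.Unary.All.Properties as All
open import Data.List.Relation.Unary.AllPairs using ([]; _∷_)
open import Data.List.Relation.Unary.Unique.Propositional using (Unique)
import Data.List.Relation.Unary.Unique.Propositional.Properties as Unique
open import Algebra.Properties.CommutativeMonoid.Sum ℤ.+-0-commutativeMonoid
  using (sum; sum-cong-≗; sum-remove; sum-init-last; ∑-distrib-+)
open import Data.Product using (Σ; ∃; _×_; _,_; proj₁; proj₂)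
open import Data.Sum using (_⊎_; inj₁; inj₂)
open import Data.Empty using (⊥; ⊥-elim)
open import Function using (_∘_; flip; mk⇔)
open import Relation.Nullary using (¬_; yes; no)
open import Relation.Binary.PropositionalEquality
open import Relation.Binary.Construct.Closure.ReflexiveTransitive as Star using (Star; ε; _◅_; _◅◅_)
open import Relation.Binary.Construct.Closure.Symmetric using (fwd; bwd)
open import Relation.Binary.Construct.Closure.Equivalence using (EqClosure)

private variable
  A : Set

Unique-same-members⇒length≡ : {xs ys : List A} → Unique xs → Unique ys →
  (∀ {x} → x ∈ xs → x ∈ ys) → (∀ {x} → x ∈ ys → x ∈ xs) → length xs ≡ length ys
Unique-same-members⇒length≡ uxs uys xs⊆ys ys⊆xs =
  ↭-length (∼bag⇒↭ (unique∧set⇒bag uxs uys (mk⇔ xs⊆ys ys⊆xs)))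

Unique⇒lookup-injective : {xs : List A} → Unique xs →
  ∀ i j → List.lookup xs i ≡ List.lookup xs j → i ≡ j
Unique⇒lookup-injective {xs = _ List.∷ _} _ zero zero _ = refl
Unique⇒lookup-injective {xs = _ List.∷ _} (x∉ ∷ _) zero (suc j) eq = ⊥-elim (All.lookup x∉ (∈-lookup j) eq)
Unique⇒lookup-injective {xs = _ List.∷ _} (x∉ ∷ _) (suc i) zero eq = ⊥-elim (All.lookup x∉ (∈-lookup i) (sym eq))
Unique⇒lookup-injective {xs = _ List.∷ _} (_ ∷ u) (suc i) (suc j) eq = cong suc (Unique⇒lookup-injective u i j eq)

Unique-map⁺ : ∀ {B : Set} (f : A → B) {xs} → (∀ {a b} → a ∈ xs → b ∈ xs → f a ≡ f b → a ≡ b) →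
              Unique xs → Unique (map f xs)
Unique-map⁺ f {List.[]} _ _ = []
Unique-map⁺ f {x List.∷ xs} injective (x∉ ∷ u) =
  All.map⁺ (All.tabulate λ {y} y∈ fx≡fy → All.lookup x∉ y∈ (injective (here refl) (there y∈) fx≡fy))
  ∷ Unique-map⁺ f (λ a∈ b∈ → injective (there a∈) (there b∈)) u

-- Weak compositions
incrementHead : ∀ {n} → Vec ℕ (suc n) → Vec ℕ (suc n)
incrementHead (x ∷ xs) = suc x ∷ xs

incrementHead-injective : ∀ {n} {xs ys : Vec ℕ (suc n)} → incrementHead xs ≡ incrementHead ys → xs ≡ ys
incrementHead-injective {xs = _ ∷ _} {_ ∷ _} refl = refl

compositions : (k t : ℕ) → List (Vec ℕ (suc k))
compositions zero t = List.[ t ∷ [] ]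
compositions (suc k) zero = List.[ Vec.replicate (suc (suc k)) 0 ]
compositions (suc k) (suc t) =
  map (0 ∷_) (compositions k (suc t)) ++ map incrementHead (compositions (suc k) t)

length-compositions : ∀ k t → length (compositions k t) ≡ (t ℕ.+ k) C k
length-compositions zero t = cong (_C 0) (sym (ℕ.+-identityʳ t))
length-compositions (suc k) zero = sym (nCn≡1 (suc k))
length-compositions (suc k) (suc t) = begin
  length (map (0 ∷_) (compositions k (suc t)) ++ map incrementHead (compositions (suc k) t))
    ≡⟨ List.length-++ (map (0 ∷_) (compositions k (suc t))) ⟩
  length (map (0 ∷_) (compositions k (suc t))) ℕ.+ length (map incrementHead (compositions (suc k) t))
    ≡⟨ cong₂ ℕ._+_ (List.length-map (0 ∷_) (compositions k (suc t)))
                   (List.length-map incrementHead (compositions (suc k) t)) ⟩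
  length (compositions k (suc t)) ℕ.+ length (compositions (suc k) t)
    ≡⟨ cong₂ ℕ._+_ (length-compositions k (suc t)) (length-compositions (suc k) t) ⟩
  (suc t ℕ.+ k) C k ℕ.+ (t ℕ.+ suc k) C suc k
    ≡⟨ cong (λ n → n C k ℕ.+ (t ℕ.+ suc k) C suc k) (sym (ℕ.+-suc t k)) ⟩
  (t ℕ.+ suc k) C k ℕ.+ (t ℕ.+ suc k) C suc k
    ≡⟨ nCk+nC[k+1]≡[n+1]C[k+1] (t ℕ.+ suc k) k ⟩
  (suc t ℕ.+ suc k) C suc k ∎
  where open ≡-Reasoning

∈-compositions⁺ : ∀ k t (e : Vec ℕ (suc k)) → Vec.sum e ≡ t → e ∈ compositions k t
∈-compositions⁺ zero t (x ∷ []) sum≡t = here (cong (_∷ []) (trans (sym (ℕ.+-identityʳ x)) sum≡t))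
∈-compositions⁺ (suc k) zero e sum≡0 = here (sum≡0⇒replicate e sum≡0)
  where
  sum≡0⇒replicate : ∀ {n} (e : Vec ℕ n) → Vec.sum e ≡ 0 → e ≡ Vec.replicate n 0
  sum≡0⇒replicate [] _ = refl
  sum≡0⇒replicate (zero ∷ e) h = cong (0 ∷_) (sum≡0⇒replicate e h)
∈-compositions⁺ (suc k) (suc t) (zero ∷ xs) sum≡t =
  ∈-++⁺ˡ (∈-map⁺ (0 ∷_) (∈-compositions⁺ k (suc t) xs sum≡t))
∈-compositions⁺ (suc k) (suc t) (suc x ∷ xs) sum≡t =
  ∈-++⁺ʳ (map (0 ∷_) (compositions k (suc t)))
    (∈-map⁺ incrementHead (∈-compositions⁺ (suc k) t (x ∷ xs) (ℕ.suc-injective sum≡t)))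

∈-compositions⁻ : ∀ k t {e : Vec ℕ (suc k)} → e ∈ compositions k t → Vec.sum e ≡ t
∈-compositions⁻ zero t (here refl) = ℕ.+-identityʳ t
∈-compositions⁻ (suc k) zero (here refl) = sum-replicate-0 (suc (suc k))
  where
  sum-replicate-0 : ∀ n → Vec.sum (Vec.replicate n 0) ≡ 0
  sum-replicate-0 zero = refl
  sum-replicate-0 (suc n) = sum-replicate-0 n
∈-compositions⁻ (suc k) (suc t) e∈ with ∈-++⁻ (map (0 ∷_) (compositions k (suc t))) e∈
... | inj₁ e∈₁ with ∈-map⁻ (0 ∷_) e∈₁
...   | _ , e′∈ , refl = ∈-compositions⁻ k (suc t) e′∈
∈-compositions⁻ (suc k) (suc t) e∈ | inj₂ e∈₂ with ∈-map⁻ incrementHead e∈₂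
...   | (_ ∷ _) , e′∈ , refl = cong suc (∈-compositions⁻ (suc k) t e′∈)

compositions-unique : ∀ k t → Unique (compositions k t)
compositions-unique zero t = All.[] ∷ []
compositions-unique (suc k) zero = All.[] ∷ []
compositions-unique (suc k) (suc t) =
  Unique.++⁺ (Unique.map⁺ (proj₂ ∘ Vec.∷-injective) (compositions-unique k (suc t)))
             (Unique.map⁺ incrementHead-injective (compositions-unique (suc k) t))
             disjoint
  where
  disjoint : ∀ {e} → ¬ (e ∈ map (0 ∷_) (compositions k (suc t)) × e ∈ map incrementHead (compositions (suc k) t))
  disjoint (e∈₁ , e∈₂) with ∈-map⁻ (0 ∷_) e∈₁ | ∈-map⁻ incrementHead e∈₂
  ... | _ , _ , refl | (_ ∷ _) , _ , ()

i-j+j≡i : ∀ i j → i - j + j ≡ i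
i-j+j≡i = solve-∀

i+j-j≡i : ∀ i j → i + j - j ≡ i
i+j-j≡i = solve-∀

+-cancelʳ-≡ : ∀ {i j} k → i + k ≡ j + k → i ≡ j
+-cancelʳ-≡ {i} {j} k eq = trans (sym (i+j-j≡i i k)) (trans (cong (_- k) eq) (i+j-j≡i j k))

+-right-comm : ∀ i j k → i + j + k ≡ i + k + j
+-right-comm = solve-∀

differences-equal : ∀ {a b a′ b′} → a - b ≡ a′ - b′ → a - a′ ≡ b - b′
differences-equal {a} {b} {a′} {b′} eq = begin
  a - a′                              ≡⟨ identity₁ a b a′ b′ ⟩
  (a - b) - (a′ - b′) + (b - b′)      ≡⟨ cong (λ x → x - (a′ - b′) + (b - b′)) eq ⟩
  (a′ - b′) - (a′ - b′) + (b - b′)    ≡⟨ identity₂ (a′ - b′) (b - b′) ⟩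
  b - b′                              ∎
  where
  open ≡-Reasoning
  identity₁ : ∀ a b a′ b′ → a - a′ ≡ (a - b) - (a′ - b′) + (b - b′)
  identity₁ = solve-∀
  identity₂ : ∀ x y → x - x + y ≡ y
  identity₂ = solve-∀

cancel-sides : ∀ {L R x y x′ y′} K → x + y ≡ x′ + y′ + K → L + x + y ≡ R + x′ + y′ → L + K ≡ R
cancel-sides {L} {R} {x} {y} {x′} {y′} K xy≡ sides≡ = begin
  L + K                            ≡⟨ identity₁ L K x y ⟩
  L + x + y - (x + y - K)          ≡⟨ cong₂ (λ a b → a - (b - K)) sides≡ xy≡ ⟩
  R + x′ + y′ - (x′ + y′ + K - K)  ≡⟨ identity₂ R x′ y′ K ⟩
  R                                ∎
  where
  open ≡-Reasoning
  identity₁ : ∀ L K x y → L + K ≡ L + x + y - (x + y - K)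
  identity₁ = solve-∀
  identity₂ : ∀ R x y K → R + x + y - (x + y + K - K) ≡ R
  identity₂ = solve-∀

square-identity : ∀ a b e n i {j} → j ≡ i + n ℤ.* e - 1ℤ →
  (n ℤ.* a + i) ℤ.* (n ℤ.* a + i) + (n ℤ.* b + j) ℤ.* (n ℤ.* b + j) ≡
  (n ℤ.* (b + e) + i) ℤ.* (n ℤ.* (b + e) + i) + (n ℤ.* (a - e) + j) ℤ.* (n ℤ.* (a - e) + j)
    + + 2 ℤ.* n ℤ.* (a - b - e)
square-identity a b e n i refl = identity a b e n i
  where
  identity : ∀ a b e n i →
    (n ℤ.* a + i) ℤ.* (n ℤ.* a + i) + (n ℤ.* b + (i + n ℤ.* e - 1ℤ)) ℤ.* (n ℤ.* b + (i + n ℤ.* e - 1ℤ)) ≡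
    (n ℤ.* (b + e) + i) ℤ.* (n ℤ.* (b + e) + i)
      + (n ℤ.* (a - e) + (i + n ℤ.* e - 1ℤ)) ℤ.* (n ℤ.* (a - e) + (i + n ℤ.* e - 1ℤ))
      + + 2 ℤ.* n ℤ.* (a - b - e)
  identity = solve-∀

+-mono-≤-neg : ∀ {i j} n → i ℤ.≤ - + n → j ℤ.≤ - + n → i + j ℤ.≤ - + n
+-mono-≤-neg {i} {j} n i≤ j≤ = begin
  i + j            ≤⟨ ℤ.+-mono-≤ i≤ j≤ ⟩
  - + n + - + n    ≤⟨ ℤ.+-monoʳ-≤ (- + n) (ℤ.neg-mono-≤ (ℤ.+≤+ ℕ.z≤n)) ⟩
  - + n + 0ℤ       ≡⟨ ℤ.+-identityʳ (- + n) ⟩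
  - + n            ∎
  where open ℤ.≤-Reasoning

0≤i*i : ∀ i → 0ℤ ℤ.≤ i ℤ.* i
0≤i*i (+ m) = subst (0ℤ ℤ.≤_) (sym (ℤ.+◃n≡+n (m ℕ.* m))) (ℤ.+≤+ ℕ.z≤n)
0≤i*i -[1+ m ] = subst (0ℤ ℤ.≤_) (sym (ℤ.+◃n≡+n (suc m ℕ.* suc m))) (ℤ.+≤+ ℕ.z≤n)

∣i∣≤∣i*i∣ : ∀ i → ℤ.∣ i ∣ ≤ ℤ.∣ i ℤ.* i ∣
∣i∣≤∣i*i∣ i rewrite ℤ.abs-* i i with ℤ.∣ i ∣
... | zero = ℕ.z≤n
... | suc m = ℕ.m≤m*n (suc m) (suc m)

0≤i≤j⇒∣i∣≤∣j∣ : ∀ {i j} → 0ℤ ℤ.≤ i → i ℤ.≤ j → ℤ.∣ i ∣ ≤ ℤ.∣ j ∣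
0≤i≤j⇒∣i∣≤∣j∣ {+ _} {+ _} _ (ℤ.+≤+ m≤n) = m≤n

residue-unique : ∀ {n r s} k → + s ≡ + r + + n ℤ.* k → r ℕ.< n → s ℕ.< n → k ≡ 0ℤ
residue-unique (+ zero) _ _ _ = refl
residue-unique {n} {r} {s} (+ suc m) s≡ _ s<n = ⊥-elim (ℕ.<⇒≱ s<n (begin
  n                    ≤⟨ ℕ.m≤m*n n (suc m) ⟩
  n ℕ.* suc m          ≤⟨ ℕ.m≤n+m (n ℕ.* suc m) r ⟩
  r ℕ.+ n ℕ.* suc m    ≡⟨ ℤ.+-injective (trans (ℤ.pos-+ r (n ℕ.* suc m))
                            (trans (cong (ℤ._+_ (+ r)) (ℤ.pos-* n (suc m))) (sym s≡))) ⟩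
  s                    ∎))
  where open ℕ.≤-Reasoning
residue-unique {n} {r} {s} -[1+ m ] s≡ r<n _ = ⊥-elim (ℕ.<⇒≱ r<n (begin
  n                    ≤⟨ ℕ.m≤m*n n (suc m) ⟩
  n ℕ.* suc m          ≤⟨ ℕ.m≤n+m (n ℕ.* suc m) s ⟩
  s ℕ.+ n ℕ.* suc m    ≡⟨ ℤ.+-injective (trans (ℤ.pos-+ s (n ℕ.* suc m))
                            (trans (cong₂ _+_ s≡ (ℤ.pos-* n (suc m))) (identity (+ r) (+ n) (+ suc m)))) ⟩
  r                    ∎))
  where
  open ℕ.≤-Reasoning
  identity : ∀ r n m → r + n ℤ.* - m + n ℤ.* m ≡ r
  identity = solve-∀

-- Ascent along a potential
fuel-for : ∀ x y → x ℤ.≤ y → ∃ λ k → y ℤ.< x + + k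
fuel-for x y x≤y = suc ℤ.∣ y - x ∣ , (begin-strict
  y                        ≡⟨ solve (x List.∷ y List.∷ List.[]) ⟩
  x + (y - x)              ≡⟨ cong (λ n → x + n) (sym (ℤ.0≤i⇒+∣i∣≡i (ℤ.i≤j⇒0≤j-i x≤y))) ⟩
  x + + ℤ.∣ y - x ∣        <⟨ ℤ.+-monoʳ-< x (ℤ.+<+ (ℕ.n<1+n _)) ⟩
  x + + suc ℤ.∣ y - x ∣    ∎)
  where open ℤ.≤-Reasoning

fuel-spend : ∀ {x y z} k → z ℤ.< x + + suc k → x ℤ.< y → z ℤ.< y + + k
fuel-spend {x} {y} {z} k z<x+k+1 x<y = begin-strict
  z              <⟨ z<x+k+1 ⟩
  x + + suc k    ≡⟨ solve (x List.∷ List.[]) ⟩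
  (1ℤ + x) + + k ≤⟨ ℤ.+-monoˡ-≤ (+ k) (ℤ.i<j⇒suc[i]≤j x<y) ⟩
  y + + k        ∎
  where open ℤ.≤-Reasoning

fuel-exhausted : ∀ {x y} → y ℤ.< x + + 0 → x ℤ.≤ y → ⊥
fuel-exhausted {x} y<x+0 x≤y = ℤ.<⇒≱ (subst (_ ℤ.<_) (ℤ.+-identityʳ x) y<x+0) x≤y

EqClosure-flip : ∀ {R : A → A → Set} {x y} → EqClosure R x y → EqClosure (flip R) x y
EqClosure-flip = Star.map λ { (fwd r) → bwd r ; (bwd r) → fwd r }

module Ascent {A : Set} (_⇝_ : A → A → Set) (Φ : A → ℤ)
              (Φ-increasing : ∀ {a b} → a ⇝ b → Φ a ℤ.< Φ b) where

  infix 4 _⇝*_ _∼_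
  _⇝*_ _∼_ : A → A → Set
  _⇝*_ = Star _⇝_
  _∼_ = EqClosure _⇝_

  Terminal : A → Set
  Terminal t = ∀ a → ¬ (t ⇝ a)

  Φ-monotone : ∀ {a b} → a ⇝* b → Φ a ℤ.≤ Φ b
  Φ-monotone ε = ℤ.≤-refl
  Φ-monotone (a⇝ ◅ ⇝*b) = ℤ.≤-trans (ℤ.<⇒≤ (Φ-increasing a⇝)) (Φ-monotone ⇝*b)

  Joinable : A → A → Set
  Joinable a b = ∃ λ e → a ⇝* e × b ⇝* e

  module _ (locally-confluent : ∀ {c a b} → c ⇝ a → c ⇝ b → Joinable a b) where

    private
      -- Newman's lemma by induction on the fuel k bounding Φ t - Φ c.
      ⇝*-terminal-fuel : ∀ k {t c c′} → Terminal t → c ⇝* t → Φ t ℤ.< Φ c + + k →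
                         c ⇝* c′ → c′ ⇝* t
      ⇝*-terminal-fuel k _ c⇝*t _ ε = c⇝*t
      ⇝*-terminal-fuel zero _ c⇝*t bound (_ ◅ _) = ⊥-elim (fuel-exhausted bound (Φ-monotone c⇝*t))
      ⇝*-terminal-fuel (suc k) t-terminal ε _ (c⇝b ◅ _) = ⊥-elim (t-terminal _ c⇝b)
      ⇝*-terminal-fuel (suc k) t-terminal (c⇝a ◅ a⇝*t) bound (c⇝b ◅ b⇝*c′)
        with locally-confluent c⇝a c⇝b
      ... | e , a⇝*e , b⇝*e =
        ⇝*-terminal-fuel k t-terminal (b⇝*e ◅◅ e⇝*t) (fuel-spend k bound (Φ-increasing c⇝b)) b⇝*c′
        where
        e⇝*t = ⇝*-terminal-fuel k t-terminal a⇝*t (fuel-spend k bound (Φ-increasing c⇝a)) a⇝*e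

    ⇝*-terminal : ∀ {t c c′} → Terminal t → c ⇝* t → c ⇝* c′ → c′ ⇝* t
    ⇝*-terminal {t} {c} t-terminal c⇝*t =
      ⇝*-terminal-fuel (proj₁ fuel) t-terminal c⇝*t (proj₂ fuel)
      where fuel = fuel-for (Φ c) (Φ t) (Φ-monotone c⇝*t)

    ∼-⇝*-terminal : ∀ {t c d} → Terminal t → c ⇝* t → c ∼ d → d ⇝* t
    ∼-⇝*-terminal _ c⇝*t ε = c⇝*t
    ∼-⇝*-terminal t-terminal c⇝*t (fwd c⇝e ◅ e∼d) =
      ∼-⇝*-terminal t-terminal (⇝*-terminal t-terminal c⇝*t (c⇝e ◅ ε)) e∼d
    ∼-⇝*-terminal t-terminal c⇝*t (bwd e⇝c ◅ e∼d) =
      ∼-⇝*-terminal t-terminal (e⇝c ◅ c⇝*t) e∼d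

    terminal-unique : ∀ {t₁ t₂} → Terminal t₁ → Terminal t₂ → t₁ ∼ t₂ → t₁ ≡ t₂
    terminal-unique t₁-terminal t₂-terminal t₁∼t₂ with ∼-⇝*-terminal t₁-terminal ε t₁∼t₂
    ... | ε = refl
    ... | t₂⇝ ◅ _ = ⊥-elim (t₂-terminal _ t₂⇝)

    Φ-maximal-at-terminal : ∀ {t d} → Terminal t → t ∼ d → Φ d ℤ.≤ Φ t
    Φ-maximal-at-terminal t-terminal t∼d = Φ-monotone (∼-⇝*-terminal t-terminal ε t∼d)

  module _ (terminal? : ∀ a → Terminal a ⊎ ∃ (a ⇝_)) where

    private
      maxΦ : List A → ℤ
      maxΦ List.[] = 0ℤ
      maxΦ (x List.∷ xs) = Φ x ℤ.⊔ maxΦ xs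

      Φ≤maxΦ : ∀ {x} xs → x ∈ xs → Φ x ℤ.≤ maxΦ xs
      Φ≤maxΦ (y List.∷ xs) (here refl) = ℤ.i≤i⊔j (Φ y) (maxΦ xs)
      Φ≤maxΦ (y List.∷ xs) (there x∈) = ℤ.≤-trans (Φ≤maxΦ xs x∈) (ℤ.i≤j⊔i (Φ y) (maxΦ xs))

      climb : ∀ k {c x} (L : List A) → (∀ d → c ∼ d → d ∈ L) → c ∼ x → maxΦ L ℤ.< Φ x + + k →
              ∃ λ t → Terminal t × c ∼ t
      climb zero L covers c∼x bound = ⊥-elim (fuel-exhausted bound (Φ≤maxΦ L (covers _ c∼x)))
      climb (suc k) {x = x} L covers c∼x bound with terminal? x
      ... | inj₁ x-terminal = x , x-terminal , c∼x
      ... | inj₂ (_ , x⇝a) =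
        climb k L covers (c∼x ◅◅ fwd x⇝a ◅ ε) (fuel-spend k bound (Φ-increasing x⇝a))

    finite-class⇒terminal : ∀ c (L : List A) → (∀ d → c ∼ d → d ∈ L) → ∃ λ t → Terminal t × c ∼ t
    finite-class⇒terminal c L covers = climb (proj₁ fuel) L covers ε (proj₂ fuel)
      where fuel = fuel-for (Φ c) (maxΦ L) (Φ≤maxΦ L (covers c ε))

Vec-ext : ∀ {n} {u v : Vec A n} → (∀ i → lookup u i ≡ lookup v i) → u ≡ v
Vec-ext {u = []} {[]} _ = refl
Vec-ext {u = x ∷ u} {y ∷ v} eq = cong₂ _∷_ (eq zero) (Vec-ext (eq ∘ suc))

lookup-∷ʳ-inject₁ : ∀ {n} (xs : Vec A n) x k → lookup (xs ∷ʳ x) (inject₁ k) ≡ lookup xs k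
lookup-∷ʳ-inject₁ (y ∷ xs) x zero = refl
lookup-∷ʳ-inject₁ (y ∷ xs) x (suc k) = lookup-∷ʳ-inject₁ xs x k

lookup-∷ʳ-fromℕ : ∀ {n} (xs : Vec A n) x → lookup (xs ∷ʳ x) (fromℕ n) ≡ x
lookup-∷ʳ-fromℕ [] x = refl
lookup-∷ʳ-fromℕ (y ∷ xs) x = lookup-∷ʳ-fromℕ xs x

init-∷ʳ-last : ∀ {n} (xs : Vec A (suc n)) → Vec.init xs ∷ʳ Vec.last xs ≡ xs
init-∷ʳ-last xs = sym (proj₂ (proj₂ (Vec.initLast xs)))

lookup-init : ∀ {n} (xs : Vec A (suc n)) k → lookup (Vec.init xs) k ≡ lookup xs (inject₁ k)
lookup-init xs k = trans (sym (lookup-∷ʳ-inject₁ (Vec.init xs) (Vec.last xs) k))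
                         (cong (λ ys → lookup ys (inject₁ k)) (init-∷ʳ-last xs))

lookup-fromℕ : ∀ {n} (xs : Vec A (suc n)) → lookup xs (fromℕ n) ≡ Vec.last xs
lookup-fromℕ xs = trans (cong (λ ys → lookup ys (fromℕ _)) (sym (init-∷ʳ-last xs)))
                        (lookup-∷ʳ-fromℕ (Vec.init xs) (Vec.last xs))

sumℤ-∷ʳ : ∀ {n} (xs : Vec ℤ n) x → sumℤ (xs ∷ʳ x) ≡ sumℤ xs + x
sumℤ-∷ʳ [] x = trans (ℤ.+-identityʳ x) (sym (ℤ.+-identityˡ x))
sumℤ-∷ʳ (y ∷ xs) x = trans (cong (ℤ._+_ y) (sumℤ-∷ʳ xs x)) (sym (ℤ.+-assoc y (sumℤ xs) x))

partialSums : ∀ {n} → ℤ → Vec ℤ n → Vec ℤ (suc n)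
partialSums a [] = a ∷ []
partialSums a (x ∷ xs) = a ∷ partialSums (a + x) xs

lookup-partialSums-zero : ∀ {n} a (xs : Vec ℤ n) → lookup (partialSums a xs) zero ≡ a
lookup-partialSums-zero a [] = refl
lookup-partialSums-zero a (x ∷ xs) = refl

lookup-partialSums-suc : ∀ {n} a (xs : Vec ℤ n) k →
  lookup (partialSums a xs) (suc k) ≡ lookup (partialSums a xs) (inject₁ k) + lookup xs k
lookup-partialSums-suc a (x ∷ xs) zero = lookup-partialSums-zero (a + x) xs
lookup-partialSums-suc a (x ∷ xs) (suc k) = lookup-partialSums-suc (a + x) xs k

constant-by-steps : ∀ {m} (f : Fin (suc m) → A) → (∀ k → f (suc k) ≡ f (inject₁ k)) → ∀ i → f i ≡ f zero
constant-by-steps f step zero = refl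
constant-by-steps {m = suc m} f step (suc i) = trans (constant-by-steps (f ∘ suc) (step ∘ suc) i) (step zero)

sumℤ≡sum∘lookup : ∀ {n} (c : Vec ℤ n) → sumℤ c ≡ sum (lookup c)
sumℤ≡sum∘lookup [] = refl
sumℤ≡sum∘lookup (x ∷ c) = cong (ℤ._+_ x) (sumℤ≡sum∘lookup c)

sum-neg : ∀ {n} (f : Fin n → ℤ) → sum (λ i → - f i) ≡ - sum f
sum-neg {zero} f = refl
sum-neg {suc n} f = trans (cong (ℤ._+_ (- f zero)) (sum-neg (f ∘ suc))) (sym (ℤ.neg-distrib-+ (f zero) _))

sum-minus : ∀ {n} (f g : Fin n → ℤ) → sum (λ i → f i - g i) ≡ sum f - sum g
sum-minus f g = trans (∑-distrib-+ f (λ i → - g i)) (cong (ℤ._+_ (sum f)) (sum-neg g))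

sum-const : ∀ n x → sum {n} (λ _ → x) ≡ + n ℤ.* x
sum-const zero x = sym (ℤ.*-zeroˡ x)
sum-const (suc n) x = trans (cong (ℤ._+_ x) (sum-const n x)) (sym (ℤ.suc-* (+ n) x))

sum-pos : ∀ {n} (e : Vec ℕ n) → + Vec.sum e ≡ sum (λ i → + lookup e i)
sum-pos [] = refl
sum-pos (x ∷ e) = trans (ℤ.pos-+ x (Vec.sum e)) (cong (ℤ._+_ (+ x)) (sum-pos e))

sum-nonneg : ∀ {n} (f : Fin n → ℤ) → (∀ i → 0ℤ ℤ.≤ f i) → 0ℤ ℤ.≤ sum f
sum-nonneg {zero} f _ = ℤ.≤-refl
sum-nonneg {suc n} f 0≤f = ℤ.+-mono-≤ (0≤f zero) (sum-nonneg (f ∘ suc) (0≤f ∘ suc))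

≤-sum-nonneg : ∀ {n} (f : Fin (suc n) → ℤ) → (∀ i → 0ℤ ℤ.≤ f i) → ∀ i → f i ℤ.≤ sum f
≤-sum-nonneg f 0≤f i = begin
  f i                             ≡⟨ sym (ℤ.+-identityʳ (f i)) ⟩
  f i + 0ℤ                        ≤⟨ ℤ.+-monoʳ-≤ (f i) (sum-nonneg (f ∘ punchIn i) (0≤f ∘ punchIn i)) ⟩
  f i + sum (f ∘ punchIn i)       ≡⟨ sym (sum-remove {i = i} f) ⟩
  sum f                           ∎
  where open ℤ.≤-Reasoning

sumℤ-map-minus : ∀ {n} (xs : Vec ℤ n) k → sumℤ (Vec.map (_- k) xs) ≡ sumℤ xs - + n ℤ.* k
sumℤ-map-minus {n} xs k = begin
  sumℤ (Vec.map (_- k) xs)            ≡⟨ sumℤ≡sum∘lookup (Vec.map (_- k) xs) ⟩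
  sum (lookup (Vec.map (_- k) xs))    ≡⟨ sum-cong-≗ (λ i → Vec.lookup-map i (_- k) xs) ⟩
  sum (λ i → lookup xs i - k)         ≡⟨ sum-minus (lookup xs) (λ _ → k) ⟩
  sum (lookup xs) - sum {n} (λ _ → k) ≡⟨ cong₂ _-_ (sym (sumℤ≡sum∘lookup xs)) (sum-const n k) ⟩
  sumℤ xs - + n ℤ.* k                 ∎
  where open ≡-Reasoning

sum-update : ∀ {n} (f h : Fin (suc n) → ℤ) j → (∀ i → i ≢ j → f i ≡ h i) → sum f + h j ≡ sum h + f j
sum-update f h j f≗h = begin
  sum f + h j                      ≡⟨ cong (_+ h j) (sum-remove {i = j} f) ⟩
  f j + sum (f ∘ punchIn j) + h j  ≡⟨ cong (λ s → f j + s + h j) (sum-cong-≗ (λ i → f≗h _ (Fin.punchInᵢ≢i j i))) ⟩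
  f j + sum (h ∘ punchIn j) + h j  ≡⟨ identity (f j) (sum (h ∘ punchIn j)) (h j) ⟩
  h j + sum (h ∘ punchIn j) + f j  ≡⟨ cong (_+ f j) (sym (sum-remove {i = j} h)) ⟩
  sum h + f j                      ∎
  where
  open ≡-Reasoning
  identity : ∀ a s b → a + s + b ≡ b + s + a
  identity = solve-∀

weighted : ∀ {n} → (Fin n → ℤ → ℤ) → Vec ℤ n → ℤ
weighted φ c = sum (λ i → φ i (lookup c i))

weighted-[]≔ : ∀ {n} φ (c : Vec ℤ (suc n)) j x →
               weighted φ (c [ j ]≔ x) + φ j (lookup c j) ≡ weighted φ c + φ j x
weighted-[]≔ φ c j x = subst (λ y → weighted φ (c [ j ]≔ x) + φ j (lookup c j) ≡ weighted φ c + φ j y)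
  (Vec.lookup∘update j c x)
  (sum-update (λ i → φ i (lookup (c [ j ]≔ x) i)) (λ i → φ i (lookup c i)) j
              (λ i i≢j → cong (φ i) (Vec.lookup∘update′ i≢j c x)))

integersWithin : ℕ → List ℤ
integersWithin zero = List.[ 0ℤ ]
integersWithin (suc K) = + suc K List.∷ -[1+ K ] List.∷ integersWithin K

∈-integersWithin : ∀ {K} x → ℤ.∣ x ∣ ≤ K → x ∈ integersWithin K
∈-integersWithin {zero} (+ zero) _ = here refl
∈-integersWithin {suc K} (+ m) m≤ with m ℕ.≟ suc K
... | yes refl = here refl
... | no m≢ = there (there (∈-integersWithin (+ m) (ℕ.s≤s⁻¹ (ℕ.≤∧≢⇒< m≤ m≢))))
∈-integersWithin {suc K} -[1+ m ] m< with m ℕ.≟ K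
... | yes refl = there (here refl)
... | no m≢ = there (there (∈-integersWithin -[1+ m ] (ℕ.≤∧≢⇒< (ℕ.s≤s⁻¹ m<) m≢)))

vectorsWithin : ∀ n → ℕ → List (Vec ℤ n)
vectorsWithin zero K = List.[ [] ]
vectorsWithin (suc n) K = List.cartesianProductWith _∷_ (integersWithin K) (vectorsWithin n K)

∈-vectorsWithin : ∀ {n K} (d : Vec ℤ n) → (∀ i → ℤ.∣ lookup d i ∣ ≤ K) → d ∈ vectorsWithin n K
∈-vectorsWithin [] _ = here refl
∈-vectorsWithin (x ∷ d) bounded =
  ∈-cartesianProductWith⁺ _∷_ (∈-integersWithin x (bounded zero)) (∈-vectorsWithin d (bounded ∘ suc))

module Scopes (q v : ℕ) where

  open import Data.Integer using (_*_)

  p w : ℕ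
  p = suc (suc q)
  w = suc v

  lastIndex : Fin p
  lastIndex = fromℕ (suc q)

  prev : Fin p → Fin p
  prev zero = lastIndex
  prev (suc k) = inject₁ k

  -- The move sc₀ also shifts the two coordinates it exchanges by one.
  wrap : Fin p → ℤ
  wrap zero = 1ℤ
  wrap (suc _) = 0ℤ

  -- move ℓ c is sc_ℓ(c), which is ℓ-allowed exactly when w ≤ gap ℓ c.
  move : Fin p → Vec ℤ p → Vec ℤ p
  move ℓ c = (c [ ℓ ]≔ (lookup c (prev ℓ) + wrap ℓ)) [ prev ℓ ]≔ (lookup c ℓ - wrap ℓ)

  gap : Fin p → Vec ℤ p → ℤ
  gap ℓ c = lookup c ℓ - lookup c (prev ℓ) - wrap ℓ

  prev≢ : ∀ ℓ → prev ℓ ≢ ℓ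
  prev≢ zero ()
  prev≢ (suc k) eq = ℕ.<⇒≢ (ℕ.n<1+n (toℕ k)) (trans (sym (Fin.toℕ-inject₁ k)) (cong toℕ eq))

  prev-injective : ∀ {k ℓ} → prev k ≡ prev ℓ → k ≡ ℓ
  prev-injective {zero} {zero} _ = refl
  prev-injective {zero} {suc ℓ} eq = ⊥-elim (Fin.fromℕ≢inject₁ eq)
  prev-injective {suc k} {zero} eq = ⊥-elim (Fin.fromℕ≢inject₁ (sym eq))
  prev-injective {suc k} {suc ℓ} eq = cong suc (Fin.inject₁-injective eq)

  lookup-move-self : ∀ ℓ c → lookup (move ℓ c) ℓ ≡ lookup c (prev ℓ) + wrap ℓ
  lookup-move-self ℓ c = trans (Vec.lookup∘update′ (prev≢ ℓ ∘ sym) (c [ ℓ ]≔ _) (lookup c ℓ - wrap ℓ))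
                                (Vec.lookup∘update ℓ c _)

  lookup-move-prev : ∀ ℓ c → lookup (move ℓ c) (prev ℓ) ≡ lookup c ℓ - wrap ℓ
  lookup-move-prev ℓ c = Vec.lookup∘update (prev ℓ) (c [ ℓ ]≔ _) (lookup c ℓ - wrap ℓ)

  lookup-move-other : ∀ ℓ c {i} → i ≢ prev ℓ → i ≢ ℓ → lookup (move ℓ c) i ≡ lookup c i
  lookup-move-other ℓ c i≢prev i≢ℓ =
    trans (Vec.lookup∘update′ i≢prev (c [ ℓ ]≔ _) (lookup c ℓ - wrap ℓ))
          (Vec.lookup∘update′ i≢ℓ c (lookup c (prev ℓ) + wrap ℓ))

  swapAt≡move : ∀ k c → swapAt c (inject₁ k) (suc k) ≡ move (suc k) c
  swapAt≡move k c = begin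
    (c [ inject₁ k ]≔ lookup c (suc k)) [ suc k ]≔ lookup c (inject₁ k)
      ≡⟨ Vec.[]≔-commutes c (inject₁ k) (suc k) (prev≢ (suc k)) ⟩
    (c [ suc k ]≔ lookup c (inject₁ k)) [ inject₁ k ]≔ lookup c (suc k)
      ≡⟨ sym (cong₂ (λ x y → (c [ suc k ]≔ x) [ inject₁ k ]≔ y) (ℤ.+-identityʳ _) (ℤ.+-identityʳ _)) ⟩
    move (suc k) c ∎
    where open ≡-Reasoning

  ScStep⇒move : ∀ {c d} → ScStep p w c d → ∃ λ ℓ → + w ℤ.≤ gap ℓ c × d ≡ move ℓ c
  ScStep⇒move (scj c a zero () _)
  ScStep⇒move (scj c a (suc k) toℕb≡ w≤) with Fin.toℕ-injective {i = a} {j = inject₁ k}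
                                                 (trans (ℕ.suc-injective (sym toℕb≡)) (sym (Fin.toℕ-inject₁ k)))
  ... | refl = suc k , subst (+ w ℤ.≤_) (sym (ℤ.+-identityʳ _)) w≤ , swapAt≡move k c
  ScStep⇒move (sc0 c zero iL refl sucL≡p w<) with Fin.toℕ-injective {i = iL} {j = lastIndex}
                                                   (trans (ℕ.suc-injective sucL≡p) (sym (Fin.toℕ-fromℕ (suc q))))
  ... | refl =
    zero , subst (+ w ℤ.≤_) (ℤ.+-comm ℤ.-1ℤ (lookup c zero - lookup c lastIndex)) (ℤ.i<j⇒i≤pred[j] w<) , refl

  move⇒ScStep : ∀ ℓ c → + w ℤ.≤ gap ℓ c → ScStep p w c (move ℓ c)
  move⇒ScStep zero c w≤ = sc0 c zero lastIndex refl (cong suc (Fin.toℕ-fromℕ (suc q)))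
    (ℤ.i≤pred[j]⇒i<j (subst (+ w ℤ.≤_) (ℤ.+-comm (lookup c zero - lookup c lastIndex) ℤ.-1ℤ) w≤))
  move⇒ScStep (suc k) c w≤ = subst (ScStep p w c) (swapAt≡move k c)
    (scj c (inject₁ k) (suc k) (cong suc (sym (Fin.toℕ-inject₁ k))) (subst (+ w ℤ.≤_) (ℤ.+-identityʳ _) w≤))

  data Position (ℓ : Fin p) : Fin p → Set where
    at-self : Position ℓ ℓ
    at-prev : Position ℓ (prev ℓ)
    elsewhere : ∀ {i} → i ≢ prev ℓ → i ≢ ℓ → Position ℓ i

  position : ∀ ℓ i → Position ℓ i
  position ℓ i with i Fin.≟ ℓ | i Fin.≟ prev ℓ
  ... | yes refl | _ = at-self
  ... | no _ | yes refl = at-prev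
  ... | no i≢ℓ | no i≢prev = elsewhere i≢prev i≢ℓ

  move-involutive : ∀ ℓ c → move ℓ (move ℓ c) ≡ c
  move-involutive ℓ c = Vec-ext pointwise
    where
    pointwise : ∀ i → lookup (move ℓ (move ℓ c)) i ≡ lookup c i
    pointwise i with position ℓ i
    ... | at-self = begin
      lookup (move ℓ (move ℓ c)) ℓ        ≡⟨ lookup-move-self ℓ (move ℓ c) ⟩
      lookup (move ℓ c) (prev ℓ) + wrap ℓ ≡⟨ cong (_+ wrap ℓ) (lookup-move-prev ℓ c) ⟩
      lookup c ℓ - wrap ℓ + wrap ℓ       ≡⟨ i-j+j≡i (lookup c ℓ) (wrap ℓ) ⟩
      lookup c ℓ                         ∎
      where open ≡-Reasoning
    ... | at-prev = begin
      lookup (move ℓ (move ℓ c)) (prev ℓ)  ≡⟨ lookup-move-prev ℓ (move ℓ c) ⟩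
      lookup (move ℓ c) ℓ - wrap ℓ         ≡⟨ cong (_- wrap ℓ) (lookup-move-self ℓ c) ⟩
      lookup c (prev ℓ) + wrap ℓ - wrap ℓ  ≡⟨ i+j-j≡i (lookup c (prev ℓ)) (wrap ℓ) ⟩
      lookup c (prev ℓ)                    ∎
      where open ≡-Reasoning
    ... | elsewhere i≢prev i≢ℓ =
      trans (lookup-move-other ℓ (move ℓ c) i≢prev i≢ℓ) (lookup-move-other ℓ c i≢prev i≢ℓ)

  gap-suc : ∀ k c → gap (suc k) c ≡ lookup c (suc k) - lookup c (inject₁ k)
  gap-suc k c = ℤ.+-identityʳ (lookup c (suc k) - lookup c (inject₁ k))

  prev≢prev : ∀ {k ℓ} → k ≢ ℓ → prev k ≢ prev ℓ
  prev≢prev k≢ℓ = k≢ℓ ∘ prev-injective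

  gap-move-self : ∀ ℓ c → gap ℓ (move ℓ c) ≡ - gap ℓ c
  gap-move-self ℓ c = begin
    lookup (move ℓ c) ℓ - lookup (move ℓ c) (prev ℓ) - wrap ℓ
      ≡⟨ cong₂ (λ x y → x - y - wrap ℓ) (lookup-move-self ℓ c) (lookup-move-prev ℓ c) ⟩
    lookup c (prev ℓ) + wrap ℓ - (lookup c ℓ - wrap ℓ) - wrap ℓ
      ≡⟨ identity (lookup c ℓ) (lookup c (prev ℓ)) (wrap ℓ) ⟩
    - gap ℓ c ∎
    where
    open ≡-Reasoning
    identity : ∀ a b x → b + x - (a - x) - x ≡ - (a - b - x)
    identity = solve-∀

  gap-move-disjoint : ∀ {k ℓ} c → k ≢ ℓ → k ≢ prev ℓ → ℓ ≢ prev k → gap k (move ℓ c) ≡ gap k c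
  gap-move-disjoint {k} {ℓ} c k≢ℓ k≢prev ℓ≢prev =
    cong₂ (λ x y → x - y - wrap k) (lookup-move-other ℓ c k≢prev k≢ℓ)
                                    (lookup-move-other ℓ c (prev≢prev k≢ℓ) (ℓ≢prev ∘ sym))

  gap-prev-move : ∀ ℓ c → prev (prev ℓ) ≢ ℓ → gap (prev ℓ) (move ℓ c) ≡ gap (prev ℓ) c + gap ℓ c
  gap-prev-move ℓ c prev²≢ = begin
    lookup (move ℓ c) (prev ℓ) - lookup (move ℓ c) (prev (prev ℓ)) - wrap (prev ℓ)
      ≡⟨ cong₂ (λ x y → x - y - wrap (prev ℓ)) (lookup-move-prev ℓ c)
               (lookup-move-other ℓ c (prev≢ (prev ℓ)) prev²≢) ⟩
    lookup c ℓ - wrap ℓ - lookup c (prev (prev ℓ)) - wrap (prev ℓ)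
      ≡⟨ identity (lookup c ℓ) (lookup c (prev ℓ)) (lookup c (prev (prev ℓ))) (wrap ℓ) (wrap (prev ℓ)) ⟩
    gap (prev ℓ) c + gap ℓ c ∎
    where
    open ≡-Reasoning
    identity : ∀ a b d x y → a - x - d - y ≡ b - d - y + (a - b - x)
    identity = solve-∀

  gap-move-prev : ∀ ℓ c → prev (prev ℓ) ≢ ℓ → gap ℓ (move (prev ℓ) c) ≡ gap ℓ c + gap (prev ℓ) c
  gap-move-prev ℓ c prev²≢ = begin
    lookup (move (prev ℓ) c) ℓ - lookup (move (prev ℓ) c) (prev ℓ) - wrap ℓ
      ≡⟨ cong₂ (λ x y → x - y - wrap ℓ)
               (lookup-move-other (prev ℓ) c (prev²≢ ∘ sym) (prev≢ ℓ ∘ sym)) (lookup-move-self (prev ℓ) c) ⟩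
    lookup c ℓ - (lookup c (prev (prev ℓ)) + wrap (prev ℓ)) - wrap ℓ
      ≡⟨ identity (lookup c ℓ) (lookup c (prev ℓ)) (lookup c (prev (prev ℓ))) (wrap ℓ) (wrap (prev ℓ)) ⟩
    gap ℓ c + gap (prev ℓ) c ∎
    where
    open ≡-Reasoning
    identity : ∀ a b d x y → a - (d + y) - x ≡ a - b - x + (b - d - y)
    identity = solve-∀

  move-comm : ∀ {k ℓ} c → k ≢ ℓ → k ≢ prev ℓ → ℓ ≢ prev k → move k (move ℓ c) ≡ move ℓ (move k c)
  move-comm {k} {ℓ} c k≢ℓ k≢prev ℓ≢prev = Vec-ext pointwise
    where
    prevk≢prevℓ = prev≢prev k≢ℓ
    prevk≢ℓ = ℓ≢prev ∘ sym
    pointwise : ∀ i → lookup (move k (move ℓ c)) i ≡ lookup (move ℓ (move k c)) i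
    pointwise i with position k i
    ... | at-self = begin
      lookup (move k (move ℓ c)) k         ≡⟨ lookup-move-self k (move ℓ c) ⟩
      lookup (move ℓ c) (prev k) + wrap k  ≡⟨ cong (_+ wrap k) (lookup-move-other ℓ c prevk≢prevℓ prevk≢ℓ) ⟩
      lookup c (prev k) + wrap k           ≡⟨ sym (lookup-move-self k c) ⟩
      lookup (move k c) k                  ≡⟨ sym (lookup-move-other ℓ (move k c) k≢prev k≢ℓ) ⟩
      lookup (move ℓ (move k c)) k         ∎
      where open ≡-Reasoning
    ... | at-prev = begin
      lookup (move k (move ℓ c)) (prev k)  ≡⟨ lookup-move-prev k (move ℓ c) ⟩
      lookup (move ℓ c) k - wrap k         ≡⟨ cong (_- wrap k) (lookup-move-other ℓ c k≢prev k≢ℓ) ⟩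
      lookup c k - wrap k                  ≡⟨ sym (lookup-move-prev k c) ⟩
      lookup (move k c) (prev k)           ≡⟨ sym (lookup-move-other ℓ (move k c) prevk≢prevℓ prevk≢ℓ) ⟩
      lookup (move ℓ (move k c)) (prev k)  ∎
      where open ≡-Reasoning
    ... | elsewhere i≢prevk i≢k with position ℓ i
    ...   | at-self = begin
      lookup (move k (move ℓ c)) ℓ         ≡⟨ lookup-move-other k (move ℓ c) i≢prevk i≢k ⟩
      lookup (move ℓ c) ℓ                  ≡⟨ lookup-move-self ℓ c ⟩
      lookup c (prev ℓ) + wrap ℓ
        ≡⟨ cong (_+ wrap ℓ) (sym (lookup-move-other k c (prevk≢prevℓ ∘ sym) (k≢prev ∘ sym))) ⟩
      lookup (move k c) (prev ℓ) + wrap ℓ  ≡⟨ sym (lookup-move-self ℓ (move k c)) ⟩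
      lookup (move ℓ (move k c)) ℓ         ∎
      where open ≡-Reasoning
    ...   | at-prev = begin
      lookup (move k (move ℓ c)) (prev ℓ)  ≡⟨ lookup-move-other k (move ℓ c) i≢prevk i≢k ⟩
      lookup (move ℓ c) (prev ℓ)           ≡⟨ lookup-move-prev ℓ c ⟩
      lookup c ℓ - wrap ℓ                  ≡⟨ cong (_- wrap ℓ) (sym (lookup-move-other k c ℓ≢prev (k≢ℓ ∘ sym))) ⟩
      lookup (move k c) ℓ - wrap ℓ         ≡⟨ sym (lookup-move-prev ℓ (move k c)) ⟩
      lookup (move ℓ (move k c)) (prev ℓ)  ∎
      where open ≡-Reasoning
    ...   | elsewhere i≢prevℓ i≢ℓ = begin
      lookup (move k (move ℓ c)) i  ≡⟨ lookup-move-other k (move ℓ c) i≢prevk i≢k ⟩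
      lookup (move ℓ c) i           ≡⟨ lookup-move-other ℓ c i≢prevℓ i≢ℓ ⟩
      lookup c i                    ≡⟨ sym (lookup-move-other k c i≢prevk i≢k) ⟩
      lookup (move k c) i           ≡⟨ sym (lookup-move-other ℓ (move k c) i≢prevℓ i≢ℓ) ⟩
      lookup (move ℓ (move k c)) i  ∎
      where open ≡-Reasoning

  move-braid : ∀ ℓ c → prev (prev ℓ) ≢ ℓ →
               move (prev ℓ) (move ℓ (move (prev ℓ) c)) ≡ move ℓ (move (prev ℓ) (move ℓ c))
  move-braid ℓ c prev²≢ = Vec-ext pointwise
    where
    k = prev ℓ
    ℓ≢prevk = prev²≢ ∘ sym
    ℓ≢k = prev≢ ℓ ∘ sym
    prevk≢k = prev≢ k
    prevk≢ℓ = prev²≢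
    pointwise : ∀ i → lookup (move k (move ℓ (move k c))) i ≡ lookup (move ℓ (move k (move ℓ c))) i
    pointwise i with position ℓ i
    ... | at-self = begin
      lookup (move k (move ℓ (move k c))) ℓ         ≡⟨ lookup-move-other k (move ℓ (move k c)) ℓ≢prevk ℓ≢k ⟩
      lookup (move ℓ (move k c)) ℓ                  ≡⟨ lookup-move-self ℓ (move k c) ⟩
      lookup (move k c) k + wrap ℓ                  ≡⟨ cong (_+ wrap ℓ) (lookup-move-self k c) ⟩
      lookup c (prev k) + wrap k + wrap ℓ
        ≡⟨ cong (λ x → x + wrap k + wrap ℓ) (sym (lookup-move-other ℓ c prevk≢k prevk≢ℓ)) ⟩
      lookup (move ℓ c) (prev k) + wrap k + wrap ℓ  ≡⟨ cong (_+ wrap ℓ) (sym (lookup-move-self k (move ℓ c))) ⟩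
      lookup (move k (move ℓ c)) k + wrap ℓ         ≡⟨ sym (lookup-move-self ℓ (move k (move ℓ c))) ⟩
      lookup (move ℓ (move k (move ℓ c))) ℓ         ∎
      where open ≡-Reasoning
    ... | at-prev = begin
      lookup (move k (move ℓ (move k c))) k           ≡⟨ lookup-move-self k (move ℓ (move k c)) ⟩
      lookup (move ℓ (move k c)) (prev k) + wrap k
        ≡⟨ cong (_+ wrap k) (lookup-move-other ℓ (move k c) prevk≢k prevk≢ℓ) ⟩
      lookup (move k c) (prev k) + wrap k             ≡⟨ cong (_+ wrap k) (lookup-move-prev k c) ⟩
      lookup c k - wrap k + wrap k                    ≡⟨ i-j+j≡i (lookup c k) (wrap k) ⟩
      lookup c k                                      ≡⟨ sym (i+j-j≡i (lookup c k) (wrap ℓ)) ⟩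
      lookup c k + wrap ℓ - wrap ℓ                    ≡⟨ cong (_- wrap ℓ) (sym (lookup-move-self ℓ c)) ⟩
      lookup (move ℓ c) ℓ - wrap ℓ
        ≡⟨ cong (_- wrap ℓ) (sym (lookup-move-other k (move ℓ c) ℓ≢prevk ℓ≢k)) ⟩
      lookup (move k (move ℓ c)) ℓ - wrap ℓ           ≡⟨ sym (lookup-move-prev ℓ (move k (move ℓ c))) ⟩
      lookup (move ℓ (move k (move ℓ c))) k           ∎
      where open ≡-Reasoning
    ... | elsewhere i≢k i≢ℓ with position k i
    ...   | at-self = ⊥-elim (i≢k refl)
    ...   | at-prev = begin
      lookup (move k (move ℓ (move k c))) (prev k)  ≡⟨ lookup-move-prev k (move ℓ (move k c)) ⟩
      lookup (move ℓ (move k c)) k - wrap k         ≡⟨ cong (_- wrap k) (lookup-move-prev ℓ (move k c)) ⟩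
      lookup (move k c) ℓ - wrap ℓ - wrap k
        ≡⟨ cong (λ x → x - wrap ℓ - wrap k) (lookup-move-other k c ℓ≢prevk ℓ≢k) ⟩
      lookup c ℓ - wrap ℓ - wrap k                  ≡⟨ cong (_- wrap k) (sym (lookup-move-prev ℓ c)) ⟩
      lookup (move ℓ c) k - wrap k                  ≡⟨ sym (lookup-move-prev k (move ℓ c)) ⟩
      lookup (move k (move ℓ c)) (prev k)           ≡⟨ sym (lookup-move-other ℓ (move k (move ℓ c)) prevk≢k prevk≢ℓ) ⟩
      lookup (move ℓ (move k (move ℓ c))) (prev k)  ∎
      where open ≡-Reasoning
    ...   | elsewhere i≢prevk _ = begin
      lookup (move k (move ℓ (move k c))) i  ≡⟨ lookup-move-other k (move ℓ (move k c)) i≢prevk i≢k ⟩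
      lookup (move ℓ (move k c)) i           ≡⟨ lookup-move-other ℓ (move k c) i≢k i≢ℓ ⟩
      lookup (move k c) i                    ≡⟨ lookup-move-other k c i≢prevk i≢k ⟩
      lookup c i                             ≡⟨ sym (lookup-move-other ℓ c i≢k i≢ℓ) ⟩
      lookup (move ℓ c) i                    ≡⟨ sym (lookup-move-other k (move ℓ c) i≢prevk i≢k) ⟩
      lookup (move k (move ℓ c)) i           ≡⟨ sym (lookup-move-other ℓ (move k (move ℓ c)) i≢k i≢ℓ) ⟩
      lookup (move ℓ (move k (move ℓ c))) i  ∎
      where open ≡-Reasoning

  weighted-move : ∀ φ ℓ c →
    weighted φ (move ℓ c) + φ ℓ (lookup c ℓ) + φ (prev ℓ) (lookup c (prev ℓ)) ≡
    weighted φ c + φ ℓ (lookup c (prev ℓ) + wrap ℓ) + φ (prev ℓ) (lookup c ℓ - wrap ℓ)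
  weighted-move φ ℓ c = begin
    weighted φ (move ℓ c) + φ ℓ (lookup c ℓ) + φ (prev ℓ) (lookup c (prev ℓ))
      ≡⟨ +-right-comm (weighted φ (move ℓ c)) _ _ ⟩
    weighted φ (move ℓ c) + φ (prev ℓ) (lookup c (prev ℓ)) + φ ℓ (lookup c ℓ)
      ≡⟨ cong (λ x → weighted φ (move ℓ c) + φ (prev ℓ) x + φ ℓ (lookup c ℓ))
              (sym (Vec.lookup∘update′ (prev≢ ℓ) c (lookup c (prev ℓ) + wrap ℓ))) ⟩
    weighted φ (move ℓ c) + φ (prev ℓ) (lookup c₁ (prev ℓ)) + φ ℓ (lookup c ℓ)
      ≡⟨ cong (_+ φ ℓ (lookup c ℓ)) (weighted-[]≔ φ c₁ (prev ℓ) (lookup c ℓ - wrap ℓ)) ⟩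
    weighted φ c₁ + φ (prev ℓ) (lookup c ℓ - wrap ℓ) + φ ℓ (lookup c ℓ)
      ≡⟨ +-right-comm (weighted φ c₁) _ _ ⟩
    weighted φ c₁ + φ ℓ (lookup c ℓ) + φ (prev ℓ) (lookup c ℓ - wrap ℓ)
      ≡⟨ cong (_+ φ (prev ℓ) (lookup c ℓ - wrap ℓ)) (weighted-[]≔ φ c ℓ (lookup c (prev ℓ) + wrap ℓ)) ⟩
    weighted φ c + φ ℓ (lookup c (prev ℓ) + wrap ℓ) + φ (prev ℓ) (lookup c ℓ - wrap ℓ) ∎
    where
    open ≡-Reasoning
    c₁ = c [ ℓ ]≔ (lookup c (prev ℓ) + wrap ℓ)

  sumℤ-move : ∀ ℓ c → sumℤ (move ℓ c) ≡ sumℤ c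
  sumℤ-move ℓ c = begin
    sumℤ (move ℓ c)               ≡⟨ sumℤ≡sum∘lookup (move ℓ c) ⟩
    weighted id′ (move ℓ c)       ≡⟨ sym (ℤ.+-identityʳ _) ⟩
    weighted id′ (move ℓ c) + 0ℤ  ≡⟨ cancel-sides {L = weighted id′ (move ℓ c)} {R = weighted id′ c} 0ℤ
                                       (identity (lookup c ℓ) (lookup c (prev ℓ)) (wrap ℓ)) (weighted-move id′ ℓ c) ⟩
    weighted id′ c                ≡⟨ sym (sumℤ≡sum∘lookup c) ⟩
    sumℤ c                        ∎
    where
    open ≡-Reasoning
    id′ : Fin p → ℤ → ℤ
    id′ _ x = x
    identity : ∀ a b e → a + b ≡ b + e + (a - e) + 0ℤ
    identity = solve-∀

  -- The index term lets the cyclic move sc₀, with its shift by one, satisfy the same square-identity.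
  weight : Fin p → ℤ → ℤ
  weight i x = (+ p * x + + toℕ i) * (+ p * x + + toℕ i)

  Φ : Vec ℤ p → ℤ
  Φ = weighted weight

  toℕ-prev : ∀ ℓ → + toℕ (prev ℓ) ≡ + toℕ ℓ + + p * wrap ℓ - 1ℤ
  toℕ-prev zero = trans (cong +_ (Fin.toℕ-fromℕ (suc q))) (identity (+ q))
    where
    identity : ∀ q → 1ℤ + q ≡ 0ℤ + (1ℤ + (1ℤ + q)) * 1ℤ - 1ℤ
    identity = solve-∀
  toℕ-prev (suc k) = trans (cong +_ (Fin.toℕ-inject₁ k)) (identity (+ toℕ k) (+ p))
    where
    identity : ∀ k p → k ≡ (1ℤ + k) + p * 0ℤ - 1ℤ
    identity = solve-∀

  Φ-move : ∀ ℓ c → Φ (move ℓ c) + + 2 * + p * gap ℓ c ≡ Φ c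
  Φ-move ℓ c = cancel-sides {L = Φ (move ℓ c)} {R = Φ c} (+ 2 * + p * gap ℓ c)
    (square-identity (lookup c ℓ) (lookup c (prev ℓ)) (wrap ℓ) (+ p) (+ toℕ ℓ) (toℕ-prev ℓ))
    (weighted-move weight ℓ c)

  Φ-decreasing : ∀ {c d} → ScStep p w c d → Φ d ℤ.< Φ c
  Φ-decreasing {c} step with ScStep⇒move step
  ... | ℓ , w≤gap , refl = begin-strict
    Φ (move ℓ c)                        ≡⟨ sym (ℤ.+-identityʳ (Φ (move ℓ c))) ⟩
    Φ (move ℓ c) + 0ℤ                   <⟨ ℤ.+-monoʳ-< (Φ (move ℓ c)) 0<2pgap ⟩
    Φ (move ℓ c) + + 2 * + p * gap ℓ c  ≡⟨ Φ-move ℓ c ⟩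
    Φ c                                 ∎
    where
    open ℤ.≤-Reasoning
    0<2pgap : 0ℤ ℤ.< + 2 * + p * gap ℓ c
    0<2pgap = subst (ℤ._< + 2 * + p * gap ℓ c) (ℤ.*-zeroʳ (+ 2 * + p))
                (ℤ.*-monoˡ-<-pos (+ 2 * + p) (ℤ.<-≤-trans (ℤ.+<+ (ℕ.s≤s ℕ.z≤n)) w≤gap))

  infix 4 _⇝_
  _⇝_ : Vec ℤ p → Vec ℤ p → Set
  c ⇝ d = ScStep p w d c

  open Ascent _⇝_ Φ Φ-decreasing

  ⇝⇒move : ∀ {c d} → c ⇝ d → ∃ λ ℓ → gap ℓ c ℤ.≤ - + w × d ≡ move ℓ c
  ⇝⇒move {d = d} d⟶c with ScStep⇒move d⟶c
  ... | ℓ , w≤gap , refl =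
    ℓ , subst (ℤ._≤ - + w) (sym (gap-move-self ℓ d)) (ℤ.neg-mono-≤ w≤gap) , sym (move-involutive ℓ d)

  move⇒⇝ : ∀ ℓ c → gap ℓ c ℤ.≤ - + w → c ⇝ move ℓ c
  move⇒⇝ ℓ c gap≤ = subst (ScStep p w (move ℓ c)) (move-involutive ℓ c) (move⇒ScStep ℓ (move ℓ c) w≤gap)
    where
    w≤gap : + w ℤ.≤ gap ℓ (move ℓ c)
    w≤gap = subst₂ ℤ._≤_ (ℤ.neg-involutive (+ w)) (sym (gap-move-self ℓ c)) (ℤ.neg-mono-≤ gap≤)

  wrap-prev+wrap≤1 : ∀ ℓ → wrap (prev ℓ) + wrap ℓ ℤ.≤ 1ℤ
  wrap-prev+wrap≤1 zero = ℤ.≤-refl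
  wrap-prev+wrap≤1 (suc zero) = ℤ.≤-refl
  wrap-prev+wrap≤1 (suc (suc _)) = ℤ.+≤+ ℕ.z≤n

  -- This is the case p = 2, where ℓ and prev ℓ are the only labels.
  no-opposite-raises : ∀ ℓ c → prev (prev ℓ) ≡ ℓ → gap ℓ c ℤ.≤ - + w → gap (prev ℓ) c ℤ.≤ - + w → ⊥
  no-opposite-raises ℓ c prev²≡ gap≤ gap′≤ = ℤ.<⇒≱ (ℤ.-<- ℕ.≤-refl) (begin
    ℤ.-1ℤ                            ≤⟨ ℤ.neg-mono-≤ (wrap-prev+wrap≤1 ℓ) ⟩
    - (wrap (prev ℓ) + wrap ℓ)      ≡⟨ sym gap-sum ⟩
    gap (prev ℓ) c + gap ℓ c        ≤⟨ ℤ.+-mono-≤ (ℤ.≤-trans gap′≤ -w≤-1) (ℤ.≤-trans gap≤ -w≤-1) ⟩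
    ℤ.-[1+ 1 ]                      ∎)
    where
    open ℤ.≤-Reasoning
    -w≤-1 : - + w ℤ.≤ ℤ.-1ℤ
    -w≤-1 = ℤ.neg-mono-≤ (ℤ.+≤+ (ℕ.s≤s ℕ.z≤n))
    gap-sum : gap (prev ℓ) c + gap ℓ c ≡ - (wrap (prev ℓ) + wrap ℓ)
    gap-sum = trans (cong (λ j → lookup c (prev ℓ) - lookup c j - wrap (prev ℓ) + gap ℓ c) prev²≡)
                    (identity (lookup c ℓ) (lookup c (prev ℓ)) (wrap ℓ) (wrap (prev ℓ)))
      where
      identity : ∀ a b x y → b - a - y + (a - b - x) ≡ - (y + x)
      identity = solve-∀

  adjacent-raises-joinable : ∀ ℓ c → prev (prev ℓ) ≢ ℓ → gap ℓ c ℤ.≤ - + w → gap (prev ℓ) c ℤ.≤ - + w →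
                             Joinable (move ℓ c) (move (prev ℓ) c)
  adjacent-raises-joinable ℓ c prev²≢ gapℓ≤ gapk≤ =
    move ℓ (move k (move ℓ c)) ,
    move⇒⇝ k (move ℓ c) (at-most-w gap-k-after-ℓ (+-mono-≤-neg w gapk≤ gapℓ≤))
      ◅ move⇒⇝ ℓ (move k (move ℓ c)) (at-most-w gap-ℓ-after-ℓk gapk≤) ◅ ε ,
    move⇒⇝ ℓ (move k c) (at-most-w gap-ℓ-after-k (+-mono-≤-neg w gapℓ≤ gapk≤))
      ◅ subst (move ℓ (move k c) ⇝_) (move-braid ℓ c prev²≢)
              (move⇒⇝ k (move ℓ (move k c)) (at-most-w gap-k-after-kℓ gapℓ≤)) ◅ ε
    where
    k = prev ℓ
    at-most-w : ∀ {x y} → x ≡ y → y ℤ.≤ - + w → x ℤ.≤ - + w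
    at-most-w x≡y = subst (ℤ._≤ - + w) (sym x≡y)
    cancel : ∀ x y → - x + (y + x) ≡ y
    cancel = solve-∀
    gap-k-after-ℓ : gap k (move ℓ c) ≡ gap k c + gap ℓ c
    gap-k-after-ℓ = gap-prev-move ℓ c prev²≢
    gap-ℓ-after-k : gap ℓ (move k c) ≡ gap ℓ c + gap k c
    gap-ℓ-after-k = gap-move-prev ℓ c prev²≢
    gap-ℓ-after-ℓk : gap ℓ (move k (move ℓ c)) ≡ gap k c
    gap-ℓ-after-ℓk = begin
      gap ℓ (move k (move ℓ c))                ≡⟨ gap-move-prev ℓ (move ℓ c) prev²≢ ⟩
      gap ℓ (move ℓ c) + gap k (move ℓ c)      ≡⟨ cong₂ _+_ (gap-move-self ℓ c) gap-k-after-ℓ ⟩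
      - gap ℓ c + (gap k c + gap ℓ c)          ≡⟨ cancel (gap ℓ c) (gap k c) ⟩
      gap k c                                  ∎
      where open ≡-Reasoning
    gap-k-after-kℓ : gap k (move ℓ (move k c)) ≡ gap ℓ c
    gap-k-after-kℓ = begin
      gap k (move ℓ (move k c))                ≡⟨ gap-prev-move ℓ (move k c) prev²≢ ⟩
      gap k (move k c) + gap ℓ (move k c)      ≡⟨ cong₂ _+_ (gap-move-self k c) gap-ℓ-after-k ⟩
      - gap k c + (gap ℓ c + gap k c)          ≡⟨ cancel (gap k c) (gap ℓ c) ⟩
      gap ℓ c                                  ∎
      where open ≡-Reasoning

  raises-joinable : ∀ ℓ k c → gap ℓ c ℤ.≤ - + w → gap k c ℤ.≤ - + w → Joinable (move ℓ c) (move k c)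
  raises-joinable ℓ k c gapℓ≤ gapk≤ with ℓ Fin.≟ k | k Fin.≟ prev ℓ | ℓ Fin.≟ prev k
  ... | yes refl | _ | _ = move ℓ c , ε , ε
  ... | no _ | yes refl | _ with prev (prev ℓ) Fin.≟ ℓ
  ...   | yes prev²≡ = ⊥-elim (no-opposite-raises ℓ c prev²≡ gapℓ≤ gapk≤)
  ...   | no prev²≢ = adjacent-raises-joinable ℓ c prev²≢ gapℓ≤ gapk≤
  raises-joinable ℓ k c gapℓ≤ gapk≤ | no _ | no _ | yes refl with prev (prev k) Fin.≟ k
  ...   | yes prev²≡ = ⊥-elim (no-opposite-raises k c prev²≡ gapk≤ gapℓ≤)
  ...   | no prev²≢ = let e , a , b = adjacent-raises-joinable k c prev²≢ gapk≤ gapℓ≤ in e , b , a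
  raises-joinable ℓ k c gapℓ≤ gapk≤ | no ℓ≢k | no k≢prev | no ℓ≢prev =
    move k (move ℓ c) ,
    move⇒⇝ k (move ℓ c) (subst (ℤ._≤ - + w) (sym (gap-move-disjoint c (ℓ≢k ∘ sym) k≢prev ℓ≢prev)) gapk≤) ◅ ε ,
    subst (move k c ⇝_) (sym (move-comm c (ℓ≢k ∘ sym) k≢prev ℓ≢prev))
      (move⇒⇝ ℓ (move k c) (subst (ℤ._≤ - + w) (sym (gap-move-disjoint c ℓ≢k ℓ≢prev k≢prev)) gapℓ≤)) ◅ ε

  locally-confluent : ∀ {c a b} → c ⇝ a → c ⇝ b → Joinable a b
  locally-confluent c⇝a c⇝b with ⇝⇒move c⇝a | ⇝⇒move c⇝b
  ... | ℓ , gapℓ≤ , refl | k , gapk≤ , refl = raises-joinable ℓ k _ gapℓ≤ gapk≤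

  Top : Vec ℤ p → Set
  Top c = ∀ ℓ → - + v ℤ.≤ gap ℓ c

  Top⇒Terminal : ∀ {c} → Top c → Terminal c
  Top⇒Terminal top _ c⇝ with ⇝⇒move c⇝
  ... | ℓ , gap≤ , _ = ℤ.<⇒≱ (ℤ.neg-mono-< (ℤ.+<+ (ℕ.n<1+n v))) (ℤ.≤-trans (top ℓ) gap≤)

  Terminal⇒Top : ∀ {c} → Terminal c → Top c
  Terminal⇒Top {c} terminal ℓ with gap ℓ c ℤ.≤? - + w
  ... | yes gap≤ = ⊥-elim (terminal _ (move⇒⇝ ℓ c gap≤))
  ... | no gap≰ = subst (ℤ._≤ gap ℓ c) (identity (+ v)) (ℤ.i<j⇒suc[i]≤j (ℤ.≰⇒> gap≰))
    where
    identity : ∀ v → 1ℤ + - (1ℤ + v) ≡ - v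
    identity = solve-∀

  terminal? : ∀ c → Terminal c ⊎ ∃ (c ⇝_)
  terminal? c with Fin.any? (λ ℓ → gap ℓ c ℤ.≤? - + w)
  ... | yes (ℓ , gap≤) = inj₂ (move ℓ c , move⇒⇝ ℓ c gap≤)
  ... | no ¬raise = inj₁ λ _ c⇝ → ¬raise (let ℓ , gap≤ , _ = ⇝⇒move c⇝ in ℓ , gap≤)

  ∣lookup∣≤ : ∀ d {M} → Φ d ℤ.≤ M → ∀ i → ℤ.∣ lookup d i ∣ ≤ ℤ.∣ M ∣ ℕ.+ p
  ∣lookup∣≤ d {M} Φd≤M i = begin
    ℤ.∣ x ∣                     ≤⟨ ℕ.m≤n*m ℤ.∣ x ∣ p ⟩
    p ℕ.* ℤ.∣ x ∣               ≡⟨ sym (ℤ.abs-* (+ p) x) ⟩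
    ℤ.∣ + p * x ∣               ≡⟨ cong ℤ.∣_∣ (sym (i+j-j≡i (+ p * x) (+ toℕ i))) ⟩
    ℤ.∣ y - + toℕ i ∣           ≤⟨ ℤ.∣i-j∣≤∣i∣+∣j∣ y (+ toℕ i) ⟩
    ℤ.∣ y ∣ ℕ.+ toℕ i           ≤⟨ ℕ.+-mono-≤ ∣y∣≤∣M∣ (ℕ.<⇒≤ (Fin.toℕ<n i)) ⟩
    ℤ.∣ M ∣ ℕ.+ p               ∎
    where
    open ℕ.≤-Reasoning
    x = lookup d i
    y = + p * x + + toℕ i
    ∣y∣≤∣M∣ : ℤ.∣ y ∣ ≤ ℤ.∣ M ∣
    ∣y∣≤∣M∣ = ℕ.≤-trans (∣i∣≤∣i*i∣ y) (0≤i≤j⇒∣i∣≤∣j∣ (0≤i*i y)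
      (ℤ.≤-trans (≤-sum-nonneg (λ j → weight j (lookup d j)) (λ j → 0≤i*i (+ p * lookup d j + + toℕ j)) i) Φd≤M))

  Terminal⇒FiniteFamily : ∀ {t} → Terminal t → FiniteFamily p w t
  Terminal⇒FiniteFamily {t} terminal =
    vectorsWithin p (ℤ.∣ Φ t ∣ ℕ.+ p) ,
    λ d t∼d → ∈-vectorsWithin d (∣lookup∣≤ d (Φ-maximal-at-terminal locally-confluent terminal (EqClosure-flip t∼d)))

  FiniteFamily⇒terminal : ∀ {c} → FiniteFamily p w c → ∃ λ t → Terminal t × c ∼[ p , w ] t
  FiniteFamily⇒terminal {c} (L , covers) =
    let t , terminal , c∼t = finite-class⇒terminal terminal? c L (λ d c∼d → covers d (EqClosure-flip c∼d))
    in t , terminal , EqClosure-flip c∼t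

  same-gaps⇒shift : ∀ {c d} → (∀ k → gap (suc k) c ≡ gap (suc k) d) →
                    ∀ i → lookup c i ≡ lookup d i + (lookup c zero - lookup d zero)
  same-gaps⇒shift {c} {d} same i = begin
    lookup c i                               ≡⟨ sym (i-j+j≡i (lookup c i) (lookup d i)) ⟩
    lookup c i - lookup d i + lookup d i     ≡⟨ ℤ.+-comm (lookup c i - lookup d i) (lookup d i) ⟩
    lookup d i + (lookup c i - lookup d i)   ≡⟨ cong (ℤ._+_ (lookup d i)) (constant-by-steps difference step i) ⟩
    lookup d i + (lookup c zero - lookup d zero) ∎
    where
    open ≡-Reasoning
    difference : Fin p → ℤ
    difference j = lookup c j - lookup d j
    step : ∀ k → difference (suc k) ≡ difference (inject₁ k)
    step k = differences-equal {lookup c (suc k)} {lookup c (inject₁ k)} {lookup d (suc k)} {lookup d (inject₁ k)}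
               (trans (sym (gap-suc k c)) (trans (same k) (gap-suc k d)))

  sum∘prev : ∀ (f : Fin p → ℤ) → sum (f ∘ prev) ≡ sum f
  sum∘prev f = trans (ℤ.+-comm (f lastIndex) _) (sym (sum-init-last f))

  sum-wrap : sum wrap ≡ 1ℤ
  sum-wrap = cong (ℤ._+_ 1ℤ) (trans (sum-const (suc q) 0ℤ) (ℤ.*-zeroʳ (+ suc q)))

  sum-gaps : ∀ c → sum (λ ℓ → gap ℓ c) ≡ - 1ℤ
  sum-gaps c = begin
    sum (λ ℓ → lookup c ℓ - lookup c (prev ℓ) - wrap ℓ)
      ≡⟨ sum-minus (λ ℓ → lookup c ℓ - lookup c (prev ℓ)) wrap ⟩
    sum (λ ℓ → lookup c ℓ - lookup c (prev ℓ)) - sum wrap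
      ≡⟨ cong₂ _-_ (sum-minus (lookup c) (lookup c ∘ prev)) sum-wrap ⟩
    sum (lookup c) - sum (lookup c ∘ prev) - 1ℤ
      ≡⟨ cong (λ s → sum (lookup c) - s - 1ℤ) (sum∘prev (lookup c)) ⟩
    sum (lookup c) - sum (lookup c) - 1ℤ                       ≡⟨ cong (_- 1ℤ) (ℤ.+-inverseʳ (sum (lookup c))) ⟩
    - 1ℤ                                                       ∎
    where open ≡-Reasoning

  prev-surjective : ∀ ℓ → ∃ λ k → prev k ≡ ℓ
  prev-surjective ℓ with suc q ℕ.≟ toℕ ℓ
  ... | yes q+1≡ = zero , Fin.toℕ-injective (trans (Fin.toℕ-fromℕ (suc q)) q+1≡)
  ... | no q+1≢ = suc (lower₁ ℓ q+1≢) , Fin.inject₁-lower₁ ℓ q+1≢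

  rotate : Vec ℤ p → Vec ℤ p
  rotate c = (Vec.last c + 1ℤ) ∷ Vec.init c

  unrotate : Vec ℤ p → Vec ℤ p
  unrotate c = Vec.tail c ∷ʳ (Vec.head c - 1ℤ)

  unrotate∘rotate : ∀ c → unrotate (rotate c) ≡ c
  unrotate∘rotate c = trans (cong (Vec.init c ∷ʳ_) (i+j-j≡i (Vec.last c) 1ℤ)) (init-∷ʳ-last c)

  rotate∘unrotate : ∀ c → rotate (unrotate c) ≡ c
  rotate∘unrotate (x ∷ c) = cong₂ _∷_
    (trans (cong (_+ 1ℤ) (Vec.last-∷ʳ (x - 1ℤ) c)) (i-j+j≡i x 1ℤ)) (Vec.init-∷ʳ (x - 1ℤ) c)

  rotate-injective : ∀ {c d} → rotate c ≡ rotate d → c ≡ d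
  rotate-injective {c} {d} eq = trans (sym (unrotate∘rotate c)) (trans (cong unrotate eq) (unrotate∘rotate d))

  sumℤ-rotate : ∀ c → sumℤ (rotate c) ≡ sumℤ c + 1ℤ
  sumℤ-rotate c = begin
    Vec.last c + 1ℤ + sumℤ (Vec.init c)   ≡⟨ identity (Vec.last c) (sumℤ (Vec.init c)) ⟩
    sumℤ (Vec.init c) + Vec.last c + 1ℤ   ≡⟨ cong (_+ 1ℤ) (sym (sumℤ-∷ʳ (Vec.init c) (Vec.last c))) ⟩
    sumℤ (Vec.init c ∷ʳ Vec.last c) + 1ℤ  ≡⟨ cong (λ d → sumℤ d + 1ℤ) (init-∷ʳ-last c) ⟩
    sumℤ c + 1ℤ                           ∎
    where
    open ≡-Reasoning
    identity : ∀ x s → x + 1ℤ + s ≡ s + x + 1ℤ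
    identity = solve-∀

  gap-rotate : ∀ ℓ c → gap ℓ (rotate c) ≡ gap (prev ℓ) c
  gap-rotate zero c =
    trans (cong₂ (λ x y → x + 1ℤ - y - 1ℤ) (sym (lookup-fromℕ c)) (lookup-init c (fromℕ q)))
          (identity (lookup c lastIndex) (lookup c (inject₁ (fromℕ q))))
    where
    identity : ∀ a b → a + 1ℤ - b - 1ℤ ≡ a - b - 0ℤ
    identity = solve-∀
  gap-rotate (suc zero) c =
    trans (cong₂ (λ x y → x - (y + 1ℤ) - 0ℤ) (lookup-init c zero) (sym (lookup-fromℕ c)))
          (identity (lookup c zero) (lookup c lastIndex))
    where
    identity : ∀ a b → a - (b + 1ℤ) - 0ℤ ≡ a - b - 1ℤ
    identity = solve-∀
  gap-rotate (suc (suc j)) c =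
    cong₂ (λ x y → x - y - 0ℤ) (lookup-init c (suc j)) (lookup-init c (inject₁ j))

  Top-rotate : ∀ {c} → Top c → Top (rotate c)
  Top-rotate {c} top ℓ = subst (- + v ℤ.≤_) (sym (gap-rotate ℓ c)) (top (prev ℓ))

  Top-unrotate : ∀ {c} → Top c → Top (unrotate c)
  Top-unrotate {c} top ℓ with prev-surjective ℓ
  ... | k , refl =
    subst (- + v ℤ.≤_) (trans (cong (gap k) (sym (rotate∘unrotate c))) (gap-rotate k (unrotate c))) (top k)

  rotate^ : ℕ → Vec ℤ p → Vec ℤ p
  rotate^ zero c = c
  rotate^ (suc s) c = rotate (rotate^ s c)

  Top-rotate^ : ∀ s {c} → Top c → Top (rotate^ s c)
  Top-rotate^ zero top = top
  Top-rotate^ (suc s) {c} top = Top-rotate {rotate^ s c} (Top-rotate^ s top)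

  sumℤ-rotate^ : ∀ s c → sumℤ (rotate^ s c) ≡ sumℤ c + + s
  sumℤ-rotate^ zero c = sym (ℤ.+-identityʳ (sumℤ c))
  sumℤ-rotate^ (suc s) c = begin
    sumℤ (rotate (rotate^ s c))  ≡⟨ sumℤ-rotate (rotate^ s c) ⟩
    sumℤ (rotate^ s c) + 1ℤ      ≡⟨ cong (_+ 1ℤ) (sumℤ-rotate^ s c) ⟩
    sumℤ c + + s + 1ℤ            ≡⟨ ℤ.+-assoc (sumℤ c) (+ s) 1ℤ ⟩
    sumℤ c + (+ s + 1ℤ)          ≡⟨ cong (ℤ._+_ (sumℤ c)) (ℤ.+-comm (+ s) 1ℤ) ⟩
    sumℤ c + + suc s             ∎
    where open ≡-Reasoning

  rotate^-injective : ∀ s {c d} → rotate^ s c ≡ rotate^ s d → c ≡ d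
  rotate^-injective zero eq = eq
  rotate^-injective (suc s) eq = rotate^-injective s (rotate-injective eq)

  rotate^-surjective : ∀ s {x} → Top x → sumℤ x ≡ + s → ∃ λ y → Top y × sumℤ y ≡ 0ℤ × rotate^ s y ≡ x
  rotate^-surjective zero {x} top sum≡ = x , top , sum≡ , refl
  rotate^-surjective (suc s) {x} top sum≡ =
    let y , y-top , y-sum , y↦ = rotate^-surjective s {unrotate x} (Top-unrotate {x} top) unrotated-sum
    in y , y-top , y-sum , trans (cong rotate y↦) (rotate∘unrotate x)
    where
    unrotated-sum : sumℤ (unrotate x) ≡ + s
    unrotated-sum = +-cancelʳ-≡ 1ℤ (begin
      sumℤ (unrotate x) + 1ℤ       ≡⟨ sym (sumℤ-rotate (unrotate x)) ⟩
      sumℤ (rotate (unrotate x))   ≡⟨ cong sumℤ (rotate∘unrotate x) ⟩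
      sumℤ x                       ≡⟨ sum≡ ⟩
      + suc s                      ≡⟨ ℤ.+-comm 1ℤ (+ s) ⟩
      + s + 1ℤ                     ∎)
      where open ≡-Reasoning

  sumℤ-ScStep : ∀ {c d} → ScStep p w c d → sumℤ d ≡ sumℤ c
  sumℤ-ScStep {c} step with ScStep⇒move step
  ... | ℓ , _ , refl = sumℤ-move ℓ c

  sumℤ-family : ∀ {c d} → c ∼[ p , w ] d → sumℤ d ≡ sumℤ c
  sumℤ-family ε = refl
  sumℤ-family (fwd step ◅ rest) = trans (sumℤ-family rest) (sumℤ-ScStep step)
  sumℤ-family (bwd step ◅ rest) = trans (sumℤ-family rest) (sym (sumℤ-ScStep step))

  FiniteFamilyCount : ℕ → Set
  FiniteFamilyCount K =
    Σ ℕ λ N → Σ (Vec (Vec ℤ p) N) λ reps →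
      (p ℕ.* N ≡ K)
      × (∀ i → InC (lookup reps i) × FiniteFamily p w (lookup reps i))
      × (∀ i j → i ≢ j → ¬ (lookup reps i ∼[ p , w ] lookup reps j))
      × (∀ c → InC c → FiniteFamily p w c → ∃ λ i → c ∼[ p , w ] lookup reps i)

  -- The finite families are represented by their unique terminal members.
  countFromTerminals : ∀ (T : List (Vec ℤ p)) → Unique T →
    (∀ {x} → x ∈ T → InC x × Terminal x) → (∀ {x} → InC x → Terminal x → x ∈ T) →
    ∀ {K} → p ℕ.* length T ≡ K → FiniteFamilyCount K
  countFromTerminals T T-unique ∈T⁻ ∈T⁺ count =
    length T , reps , count , valid , inequivalent , complete
    where
    reps = Vec.tabulate (List.lookup T)
    lookup-reps : ∀ i → lookup reps i ≡ List.lookup T i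
    lookup-reps = Vec.lookup∘tabulate (List.lookup T)
    terminal : ∀ i → InC (lookup reps i) × Terminal (lookup reps i)
    terminal i = subst (λ x → InC x × Terminal x) (sym (lookup-reps i)) (∈T⁻ (∈-lookup i))
    valid : ∀ i → InC (lookup reps i) × FiniteFamily p w (lookup reps i)
    valid i = proj₁ (terminal i) , Terminal⇒FiniteFamily (proj₂ (terminal i))
    inequivalent : ∀ i j → i ≢ j → ¬ (lookup reps i ∼[ p , w ] lookup reps j)
    inequivalent i j i≢j i∼j = i≢j (Unique⇒lookup-injective T-unique i j (begin
      List.lookup T i  ≡⟨ sym (lookup-reps i) ⟩
      lookup reps i
        ≡⟨ terminal-unique locally-confluent (proj₂ (terminal i)) (proj₂ (terminal j)) (EqClosure-flip i∼j) ⟩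
      lookup reps j    ≡⟨ lookup-reps j ⟩
      List.lookup T j  ∎))
      where open ≡-Reasoning
    complete : ∀ c → InC c → FiniteFamily p w c → ∃ λ i → c ∼[ p , w ] lookup reps i
    complete c c∈C finite =
      let t , t-terminal , c∼t = FiniteFamily⇒terminal finite
          t∈T = ∈T⁺ (trans (sumℤ-family c∼t) c∈C) t-terminal
      in Any.index t∈T , subst (c ∼[ p , w ]_) (trans (Any.lookup-index t∈T) (sym (lookup-reps (Any.index t∈T)))) c∼t

module Counting (q v′ : ℕ) where

  open import Data.Integer using (_*_)
  open Scopes q (suc v′)

  v : ℕ
  v = suc v′

  S : ℕ
  S = suc q ℕ.+ p ℕ.* v′

  +S≡pv-1 : + S ≡ + p * + v - 1ℤ
  +S≡pv-1 = begin
    + (suc q ℕ.+ p ℕ.* v′)      ≡⟨ ℤ.pos-+ (suc q) (p ℕ.* v′) ⟩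
    + suc q + + (p ℕ.* v′)      ≡⟨ cong (ℤ._+_ (+ suc q)) (ℤ.pos-* p v′) ⟩
    + suc q + + p * + v′        ≡⟨ identity (+ q) (+ v′) ⟩
    + p * + v - 1ℤ              ∎
    where
    open ≡-Reasoning
    identity : ∀ q v → (1ℤ + q) + (1ℤ + (1ℤ + q)) * v ≡ (1ℤ + (1ℤ + q)) * (1ℤ + v) - 1ℤ
    identity = solve-∀

  composition : Vec ℤ p → Vec ℕ p
  composition c = Vec.tabulate (λ ℓ → ℤ.∣ gap ℓ c + + v ∣)

  lookup-composition : ∀ {c} → Top c → ∀ ℓ → + lookup (composition c) ℓ ≡ gap ℓ c + + v
  lookup-composition {c} top ℓ = trans (cong +_ (Vec.lookup∘tabulate (λ ℓ → ℤ.∣ gap ℓ c + + v ∣) ℓ))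
    (ℤ.0≤i⇒+∣i∣≡i (subst (ℤ._≤ gap ℓ c + + v) (ℤ.+-inverseˡ (+ v)) (ℤ.+-monoˡ-≤ (+ v) (top ℓ))))

  sum-composition : ∀ {c} → Top c → Vec.sum (composition c) ≡ S
  sum-composition {c} top = ℤ.+-injective (begin
    + Vec.sum (composition c)                ≡⟨ sum-pos (composition c) ⟩
    sum (λ ℓ → + lookup (composition c) ℓ)   ≡⟨ sum-cong-≗ (lookup-composition {c} top) ⟩
    sum (λ ℓ → gap ℓ c + + v)                ≡⟨ ∑-distrib-+ (λ ℓ → gap ℓ c) (λ _ → + v) ⟩
    sum (λ ℓ → gap ℓ c) + sum {p} (λ _ → + v) ≡⟨ cong₂ _+_ (sum-gaps c) (sum-const p (+ v)) ⟩
    - 1ℤ + + p * + v                         ≡⟨ ℤ.+-comm (- 1ℤ) (+ p * + v) ⟩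
    + p * + v - 1ℤ                           ≡⟨ sym +S≡pv-1 ⟩
    + S                                      ∎)
    where open ≡-Reasoning

  -- A composition e is realised by the vector whose gaps are e_ℓ - v,
  -- normalised to a coordinate sum in [0, p).
  heights : Vec ℕ p → Vec ℤ p
  heights e = partialSums 0ℤ (Vec.tabulate (λ k → + lookup e (suc k) - + v))

  offset : Vec ℕ p → ℤ
  offset e = sumℤ (heights e) DivMod./ℕ p

  residue : Vec ℕ p → ℕ
  residue e = sumℤ (heights e) DivMod.%ℕ p

  fromComposition : Vec ℕ p → Vec ℤ p
  fromComposition e = Vec.map (_- offset e) (heights e)

  gap-fromComposition-suc : ∀ e k → gap (suc k) (fromComposition e) ≡ + lookup e (suc k) - + v
  gap-fromComposition-suc e k = begin
    lookup (fromComposition e) (suc k) - lookup (fromComposition e) (inject₁ k) - 0ℤ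
      ≡⟨ cong₂ (λ x y → x - y - 0ℤ) (Vec.lookup-map (suc k) (_- offset e) (heights e))
                                    (Vec.lookup-map (inject₁ k) (_- offset e) (heights e)) ⟩
    lookup (heights e) (suc k) - offset e - (lookup (heights e) (inject₁ k) - offset e) - 0ℤ
      ≡⟨ cong (λ x → x - offset e - (lookup (heights e) (inject₁ k) - offset e) - 0ℤ)
              (lookup-partialSums-suc 0ℤ increments k) ⟩
    lookup (heights e) (inject₁ k) + lookup increments k - offset e - (lookup (heights e) (inject₁ k) - offset e) - 0ℤ
      ≡⟨ identity (lookup (heights e) (inject₁ k)) (lookup increments k) (offset e) ⟩
    lookup increments k
      ≡⟨ Vec.lookup∘tabulate (λ k → + lookup e (suc k) - + v) k ⟩
    + lookup e (suc k) - + v ∎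
    where
    open ≡-Reasoning
    increments = Vec.tabulate (λ k → + lookup e (suc k) - + v)
    identity : ∀ h x o → h + x - o - (h - o) - 0ℤ ≡ x
    identity = solve-∀

  -- The gap at 0 is forced by sum-gaps.
  gap-fromComposition-zero : ∀ e → Vec.sum e ≡ S → gap zero (fromComposition e) ≡ + lookup e zero - + v
  gap-fromComposition-zero e sum≡S = begin
    g₀                                   ≡⟨ identity₁ g₀ σ ⟩
    (g₀ + σ) - σ                         ≡⟨ cong₂ _-_ (sum-gaps (fromComposition e)) σ≡ ⟩
    - 1ℤ - (τ - + suc q * + v)           ≡⟨ identity₂ e₀ τ (+ q) (+ v) ⟩
    e₀ - + v - (e₀ + τ - (+ p * + v - 1ℤ))  ≡⟨ cong (λ x → e₀ - + v - (x - (+ p * + v - 1ℤ))) e₀+τ≡ ⟩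
    e₀ - + v - (+ p * + v - 1ℤ - (+ p * + v - 1ℤ))  ≡⟨ identity₃ e₀ (+ v) (+ p * + v - 1ℤ) ⟩
    e₀ - + v                             ∎
    where
    open ≡-Reasoning
    x = fromComposition e
    g₀ = gap zero x
    σ = sum (λ k → gap (suc k) x)
    e₀ = + lookup e zero
    τ = sum (λ k → + lookup e (suc k))
    σ≡ : σ ≡ τ - + suc q * + v
    σ≡ = trans (sum-cong-≗ (gap-fromComposition-suc e))
               (trans (sum-minus (λ k → + lookup e (suc k)) (λ _ → + v)) (cong (ℤ._-_ τ) (sum-const (suc q) (+ v))))
    e₀+τ≡ : e₀ + τ ≡ + p * + v - 1ℤ
    e₀+τ≡ = trans (sym (sum-pos e)) (trans (cong +_ sum≡S) +S≡pv-1)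
    identity₁ : ∀ g s → g ≡ g + s - s
    identity₁ = solve-∀
    identity₂ : ∀ e t q v → - 1ℤ - (t - (1ℤ + q) * v) ≡ e - v - (e + t - ((1ℤ + (1ℤ + q)) * v - 1ℤ))
    identity₂ = solve-∀
    identity₃ : ∀ e v m → e - v - (m - m) ≡ e - v
    identity₃ = solve-∀

  gap-fromComposition : ∀ e → Vec.sum e ≡ S → ∀ ℓ → gap ℓ (fromComposition e) ≡ + lookup e ℓ - + v
  gap-fromComposition e sum≡S zero = gap-fromComposition-zero e sum≡S
  gap-fromComposition e _ (suc k) = gap-fromComposition-suc e k

  Top-fromComposition : ∀ e → Vec.sum e ≡ S → Top (fromComposition e)
  Top-fromComposition e sum≡S ℓ = subst (- + v ℤ.≤_) (sym (gap-fromComposition e sum≡S ℓ))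
    (subst (ℤ._≤ + lookup e ℓ - + v) (ℤ.+-identityˡ (- + v)) (ℤ.+-monoˡ-≤ (- + v) (ℤ.+≤+ (ℕ.z≤n {lookup e ℓ}))))

  composition∘fromComposition : ∀ e → Vec.sum e ≡ S → composition (fromComposition e) ≡ e
  composition∘fromComposition e sum≡S = Vec-ext λ ℓ →
    trans (Vec.lookup∘tabulate (λ ℓ → ℤ.∣ gap ℓ (fromComposition e) + + v ∣) ℓ)
          (cong ℤ.∣_∣ (trans (cong (_+ + v) (gap-fromComposition e sum≡S ℓ)) (i-j+j≡i (+ lookup e ℓ) (+ v))))

  sumℤ-fromComposition : ∀ e → sumℤ (fromComposition e) ≡ + residue e
  sumℤ-fromComposition e = begin
    sumℤ (Vec.map (_- offset e) (heights e))       ≡⟨ sumℤ-map-minus (heights e) (offset e) ⟩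
    sumℤ (heights e) - + p * offset e
      ≡⟨ cong (_- + p * offset e) (DivMod.a≡a%ℕn+[a/ℕn]*n (sumℤ (heights e)) p) ⟩
    + residue e + offset e * + p - + p * offset e  ≡⟨ identity (+ residue e) (offset e) (+ p) ⟩
    + residue e                                    ∎
    where
    open ≡-Reasoning
    identity : ∀ r k n → r + k * n - n * k ≡ r
    identity = solve-∀

  residue<p : ∀ e → residue e ℕ.< p
  residue<p e = DivMod.n%ℕd<d (sumℤ (heights e)) p

  -- The coordinate sums pin down the constant of same-gaps⇒shift.
  fromComposition∘composition : ∀ {c s} → Top c → sumℤ c ≡ + s → s ℕ.< p → fromComposition (composition c) ≡ c
  fromComposition∘composition {c} {s} top sum≡s s<p = Vec-ext λ i → begin
    lookup x i          ≡⟨ sym (ℤ.+-identityʳ (lookup x i)) ⟩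
    lookup x i + 0ℤ     ≡⟨ cong (ℤ._+_ (lookup x i)) (sym shift≡0) ⟩
    lookup x i + shift  ≡⟨ sym (c≡x+shift i) ⟩
    lookup c i          ∎
    where
    open ≡-Reasoning
    e = composition c
    x = fromComposition e
    shift = lookup c zero - lookup x zero
    same-gaps : ∀ k → gap (suc k) c ≡ gap (suc k) x
    same-gaps k = sym (begin
      gap (suc k) x                  ≡⟨ gap-fromComposition-suc e k ⟩
      + lookup e (suc k) - + v       ≡⟨ cong (_- + v) (lookup-composition {c} top (suc k)) ⟩
      gap (suc k) c + + v - + v      ≡⟨ i+j-j≡i (gap (suc k) c) (+ v) ⟩
      gap (suc k) c                  ∎)
    c≡x+shift : ∀ i → lookup c i ≡ lookup x i + shift
    c≡x+shift = same-gaps⇒shift {c} {x} same-gaps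
    sums : + s ≡ + residue e + + p * shift
    sums = begin
      + s                                ≡⟨ sym sum≡s ⟩
      sumℤ c                             ≡⟨ sumℤ≡sum∘lookup c ⟩
      sum (lookup c)                     ≡⟨ sum-cong-≗ c≡x+shift ⟩
      sum (λ i → lookup x i + shift)     ≡⟨ ∑-distrib-+ (lookup x) (λ _ → shift) ⟩
      sum (lookup x) + sum {p} (λ _ → shift) ≡⟨ cong₂ _+_ (sym (sumℤ≡sum∘lookup x)) (sum-const p shift) ⟩
      sumℤ x + + p * shift               ≡⟨ cong (_+ + p * shift) (sumℤ-fromComposition e) ⟩
      + residue e + + p * shift          ∎
    shift≡0 : shift ≡ 0ℤ
    shift≡0 = residue-unique shift sums (residue<p e) s<p

  tops<p : List (Vec ℤ p)
  tops<p = map fromComposition (compositions (suc q) S)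

  ∈-tops<p⁻ : ∀ {x} → x ∈ tops<p → Top x × ∃ λ s → s ℕ.< p × sumℤ x ≡ + s
  ∈-tops<p⁻ x∈ with ∈-map⁻ fromComposition x∈
  ... | e , e∈ , refl =
    Top-fromComposition e (∈-compositions⁻ (suc q) S e∈) , residue e , residue<p e , sumℤ-fromComposition e

  ∈-tops<p⁺ : ∀ {x s} → Top x → sumℤ x ≡ + s → s ℕ.< p → x ∈ tops<p
  ∈-tops<p⁺ {x} top sum≡s s<p = subst (_∈ tops<p) (fromComposition∘composition top sum≡s s<p)
    (∈-map⁺ fromComposition (∈-compositions⁺ (suc q) S (composition x) (sum-composition {x} top)))

  tops<p-unique : Unique tops<p
  tops<p-unique = Unique-map⁺ fromComposition injective (compositions-unique (suc q) S)
    where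
    injective : ∀ {a b} → a ∈ compositions (suc q) S → b ∈ compositions (suc q) S →
                fromComposition a ≡ fromComposition b → a ≡ b
    injective {a} {b} a∈ b∈ eq = begin
      a                                  ≡⟨ sym (composition∘fromComposition a (∈-compositions⁻ (suc q) S a∈)) ⟩
      composition (fromComposition a)    ≡⟨ cong composition eq ⟩
      composition (fromComposition b)    ≡⟨ composition∘fromComposition b (∈-compositions⁻ (suc q) S b∈) ⟩
      b                                  ∎
      where open ≡-Reasoning

  representatives : List (Vec ℤ p)
  representatives = List.filter (λ x → sumℤ x ℤ.≟ 0ℤ) tops<p

  ∈-representatives⁻ : ∀ {x} → x ∈ representatives → Top x × sumℤ x ≡ 0ℤ
  ∈-representatives⁻ x∈ =
    let x∈tops<p , sum≡0 = ∈-filter⁻ (λ x → sumℤ x ℤ.≟ 0ℤ) x∈ in proj₁ (∈-tops<p⁻ x∈tops<p) , sum≡0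

  ∈-representatives⁺ : ∀ {x} → Top x → sumℤ x ≡ 0ℤ → x ∈ representatives
  ∈-representatives⁺ top sum≡0 =
    ∈-filter⁺ (λ x → sumℤ x ℤ.≟ 0ℤ) (∈-tops<p⁺ top sum≡0 (ℕ.s≤s ℕ.z≤n)) sum≡0

  representatives-unique : Unique representatives
  representatives-unique = Unique.filter⁺ (λ x → sumℤ x ℤ.≟ 0ℤ) tops<p-unique

  rotationsBelow : ℕ → List (Vec ℤ p)
  rotationsBelow zero = List.[]
  rotationsBelow (suc s) = rotationsBelow s ++ map (rotate^ s) representatives

  ∈-map-rotate^⁻ : ∀ s {x} → x ∈ map (rotate^ s) representatives → Top x × sumℤ x ≡ + s
  ∈-map-rotate^⁻ s x∈ with ∈-map⁻ (rotate^ s) x∈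
  ... | y , y∈ , refl =
    let y-top , y-sum = ∈-representatives⁻ y∈
    in Top-rotate^ s y-top , trans (sumℤ-rotate^ s y) (trans (cong (_+ + s) y-sum) (ℤ.+-identityˡ (+ s)))

  ∈-rotationsBelow⁻ : ∀ s {x} → x ∈ rotationsBelow s → Top x × ∃ λ s′ → s′ ℕ.< s × sumℤ x ≡ + s′
  ∈-rotationsBelow⁻ (suc s) x∈ with ∈-++⁻ (rotationsBelow s) x∈
  ... | inj₁ x∈₁ = let top , s′ , s′<s , sum≡ = ∈-rotationsBelow⁻ s x∈₁ in top , s′ , ℕ.m<n⇒m<1+n s′<s , sum≡
  ... | inj₂ x∈₂ = let top , sum≡ = ∈-map-rotate^⁻ s x∈₂ in top , s , ℕ.n<1+n s , sum≡

  ∈-rotationsBelow⁺ : ∀ s {x s′} → Top x → sumℤ x ≡ + s′ → s′ ℕ.< s → x ∈ rotationsBelow s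
  ∈-rotationsBelow⁺ (suc s) {x} {s′} top sum≡ s′<1+s with s′ ℕ.≟ s
  ... | no s′≢s = ∈-++⁺ˡ (∈-rotationsBelow⁺ s top sum≡ (ℕ.≤∧≢⇒< (ℕ.s≤s⁻¹ s′<1+s) s′≢s))
  ... | yes refl =
    let y , y-top , y-sum , y↦x = rotate^-surjective s′ top sum≡
    in ∈-++⁺ʳ (rotationsBelow s′) (subst (_∈ map (rotate^ s′) representatives) y↦x
                                     (∈-map⁺ (rotate^ s′) (∈-representatives⁺ y-top y-sum)))

  rotationsBelow-unique : ∀ s → Unique (rotationsBelow s)
  rotationsBelow-unique zero = []
  rotationsBelow-unique (suc s) =
    Unique.++⁺ (rotationsBelow-unique s) (Unique.map⁺ (rotate^-injective s) representatives-unique) disjoint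
    where
    disjoint : ∀ {x} → ¬ (x ∈ rotationsBelow s × x ∈ map (rotate^ s) representatives)
    disjoint (x∈₁ , x∈₂) =
      let _ , s′ , s′<s , sum≡s′ = ∈-rotationsBelow⁻ s x∈₁
      in ℕ.<-irrefl (ℤ.+-injective (trans (sym sum≡s′) (proj₂ (∈-map-rotate^⁻ s x∈₂)))) s′<s

  length-rotationsBelow : ∀ s → length (rotationsBelow s) ≡ s ℕ.* length representatives
  length-rotationsBelow zero = refl
  length-rotationsBelow (suc s) = begin
    length (rotationsBelow s ++ map (rotate^ s) representatives)
      ≡⟨ List.length-++ (rotationsBelow s) ⟩
    length (rotationsBelow s) ℕ.+ length (map (rotate^ s) representatives)
      ≡⟨ cong₂ ℕ._+_ (length-rotationsBelow s) (List.length-map (rotate^ s) representatives) ⟩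
    s ℕ.* length representatives ℕ.+ length representatives
      ≡⟨ ℕ.+-comm (s ℕ.* length representatives) (length representatives) ⟩
    suc s ℕ.* length representatives ∎
    where open ≡-Reasoning

  p*w∸2≡ : p ℕ.* w ∸ 2 ≡ S ℕ.+ suc q
  p*w∸2≡ = cong (_∸ 2) (identity q v′)
    where
    identity : ∀ q v → (2 ℕ.+ q) ℕ.* (2 ℕ.+ v) ≡ 2 ℕ.+ ((1 ℕ.+ q ℕ.+ (2 ℕ.+ q) ℕ.* v) ℕ.+ (1 ℕ.+ q))
    identity = ℕ-Solver.solve-∀

  count : p ℕ.* length representatives ≡ (p ℕ.* w ∸ 2) C (p ∸ 1)
  count = begin
    p ℕ.* length representatives             ≡⟨ sym (length-rotationsBelow p) ⟩
    length (rotationsBelow p)                ≡⟨ Unique-same-members⇒length≡ (rotationsBelow-unique p) tops<p-unique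
                                                  rotationsBelow⊆tops<p tops<p⊆rotationsBelow ⟩
    length tops<p                            ≡⟨ List.length-map fromComposition (compositions (suc q) S) ⟩
    length (compositions (suc q) S)          ≡⟨ length-compositions (suc q) S ⟩
    (S ℕ.+ suc q) C suc q                    ≡⟨ cong (_C suc q) (sym p*w∸2≡) ⟩
    (p ℕ.* w ∸ 2) C (p ∸ 1)                  ∎
    where
    open ≡-Reasoning
    rotationsBelow⊆tops<p : ∀ {x} → x ∈ rotationsBelow p → x ∈ tops<p
    rotationsBelow⊆tops<p x∈ = let top , s , s<p , sum≡ = ∈-rotationsBelow⁻ p x∈ in ∈-tops<p⁺ top sum≡ s<p
    tops<p⊆rotationsBelow : ∀ {x} → x ∈ tops<p → x ∈ rotationsBelow p
    tops<p⊆rotationsBelow x∈ = let top , s , s<p , sum≡ = ∈-tops<p⁻ x∈ in ∈-rotationsBelow⁺ p top sum≡ s<p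

  finiteFamilies : FiniteFamilyCount ((p ℕ.* w ∸ 2) C (p ∸ 1))
  finiteFamilies = countFromTerminals representatives representatives-unique
    (λ x∈ → let top , sum≡0 = ∈-representatives⁻ x∈ in sum≡0 , Top⇒Terminal top)
    (λ x∈C terminal → ∈-representatives⁺ (Terminal⇒Top terminal) x∈C)
    count

no-Top-for-w≡1 : ∀ q c → ¬ Scopes.Top q 0 c
no-Top-for-w≡1 q c top = ℤ.<⇒≱ (ℤ.-<+ {0} {0})
  (subst (0ℤ ℤ.≤_) (Scopes.sum-gaps q 0 c) (sum-nonneg (λ ℓ → Scopes.gap q 0 ℓ c) top))

finiteFamilies-w≡1 : ∀ q → let open Scopes q 0 in FiniteFamilyCount ((p ℕ.* w ∸ 2) C (p ∸ 1))
finiteFamilies-w≡1 q = countFromTerminals List.[] [] (λ ())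
  (λ {x} _ terminal → ⊥-elim (no-Top-for-w≡1 q x (Terminal⇒Top terminal)))
  (trans (ℕ.*-zeroʳ p) (sym (trans (cong (λ n → (n ∸ 2) C suc q) (ℕ.*-identityʳ p)) (k>n⇒nCk≡0 (ℕ.n<1+n q)))))
  where open Scopes q 0

open import Data.Nat using (_*_)

-- Primality is only used to exclude p ≤ 1.
theorem4p15 : (p w : ℕ) → Prime p → w ≥ 1 →
    Σ ℕ λ N → Σ (Vec (Vec ℤ p) N) λ reps →
    (p * N ≡ (p * w ∸ 2) C (p ∸ 1))
    × (∀ i → InC (lookup reps i) × FiniteFamily p w (lookup reps i))
    × (∀ i j → i ≢ j → ¬ (lookup reps i ∼[ p , w ] lookup reps j))
    × (∀ c → InC c → FiniteFamily p w c → ∃ λ i → c ∼[ p , w ] lookup reps i)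
theorem4p15 zero _ p-prime _ = ⊥-elim (¬prime[0] p-prime)
theorem4p15 (suc zero) _ p-prime _ = ⊥-elim (¬prime[1] p-prime)
theorem4p15 (suc (suc q)) zero _ ()
theorem4p15 (suc (suc q)) (suc zero) _ _ = finiteFamilies-w≡1 q
theorem4p15 (suc (suc q)) (suc (suc v′)) _ _ = Counting.finiteFamilies q v′
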